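{- Let $q>3$ be a prime power and let $m$ be a positive integer. Let $A_m$ denote the antichain with $m$ elements. Then the minimum distance over $\mathbb{F}_q$ of the toric code associated with the order polytope $\mathbf{O}_{A_m\oplus A_m}$ of the ordinal sum $A_m\oplus A_m$ is $(q-1)^m(q-2)^m$.
   Context: An antichain is a poset with no two distinct comparable elements. The ordinal sum $P\oplus Q$ of posets is the poset on $P\sqcup Q$ with the orders of $P$ and $Q$ and additionally $a<b$ for all $a\in P$, $b\in Q$. For a finite poset $P$ with $n$ elements, the order polytope $\mathbf{O}_P\subset\mathbb{Q}^n$ is the convex hull of the $0/1$ indicator vectors (coordinates indexed by elements of $P$) of the upper order ideals of $P$ (subsets $I$ with $y\in I,\ y\le x\Rightarrow x\in I$). Toric codes: for a full-dimensional lattice polytope $\mathbf{P}\subset\mathbb{Q}^n$, let $L_{\mathbf{P}}$ be the $\mathbb{F}_q$-span of the Laurent monomials $x^u$, $u\in\mathbf{P}\cap\mathbb{Z}^n$; the toric code $\mathcal{C}_{\mathbf{P}}$ is the image of $f\mapsto(f(t))_{t\in(\mathbb{F}_q^*)^n}$. With $Z(f)$ the number of zeros of $f$ in $(\mathbb{F}_q^*)^n$, the minimum distance is $d(\mathcal{C}_{\mathbf{P}})=(q-1)^n-\max_{0\neq f\in L_{\mathbf{P}}}Z(f)$. -}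

module Defs where

open import Level using (0ℓ)
open import Data.Nat as ℕ using (ℕ; zero; suc; _∸_; _^_; _≤_)
open import Data.Fin as Fin using (Fin; splitAt; join)
open import Data.Fin.Properties using (all?; join-splitAt)
open import Data.Integer as ℤ using (ℤ; +_; -[1+_])
import Data.Integer.Properties as ℤP
open import Data.Rational as ℚ using (ℚ; 0ℚ; 1ℚ)
open import Data.Bool using (Bool; true; false)
open import Data.List using (List; []; _∷_; map; foldr; filter; length; concatMap; allFin)
open import Data.List.Relation.Unary.All using (All)
open import Data.Product using (Σ; ∃; _×_; _,_; proj₁; proj₂)
open import Data.Sum using (_⊎_; inj₁; inj₂)
open import Data.Unit using (⊤; tt)
open import Data.Empty using (⊥)
open import Relation.Nullary using (¬_; Dec; yes; no)
open import Relation.Nullary.Decidable using (_×-dec_; ¬?)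
open import Relation.Binary using (Decidable)
open import Relation.Binary.PropositionalEquality using (_≡_; refl; cong; trans; sym)
open import Algebra.Bundles using (CommutativeRing)
import Algebra.Bundles

record FinPoset : Set₁ where
  field
    size  : ℕ
    _≼_   : Fin size → Fin size → Set
    ≼-refl    : ∀ x → x ≼ x
    ≼-antisym : ∀ x y → x ≼ y → y ≼ x → x ≡ y
    ≼-trans   : ∀ x y z → x ≼ y → y ≼ z → x ≼ z

Antichain : ℕ → FinPoset
Antichain m = record
  { size = m ; _≼_ = _≡_
  ; ≼-refl = λ _ → refl
  ; ≼-antisym = λ _ _ p _ → p
  ; ≼-trans = λ _ _ _ p q → trans p q }

-- Ordinal sum P ⊕ Q on Fin (|P| + |Q|); the first |P| elements are P.
module _ (P Q : FinPoset) where
  private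
    module P = FinPoset P
    module Q = FinPoset Q

  _≼⊎_ : Fin P.size ⊎ Fin Q.size → Fin P.size ⊎ Fin Q.size → Set
  inj₁ x ≼⊎ inj₁ y = x P.≼ y
  inj₂ x ≼⊎ inj₂ y = x Q.≼ y
  inj₁ _ ≼⊎ inj₂ _ = ⊤
  inj₂ _ ≼⊎ inj₁ _ = ⊥

  private
    r⊎ : ∀ a → a ≼⊎ a
    r⊎ (inj₁ x) = P.≼-refl x
    r⊎ (inj₂ x) = Q.≼-refl x

    a⊎ : ∀ a b → a ≼⊎ b → b ≼⊎ a → a ≡ b
    a⊎ (inj₁ x) (inj₁ y) p q = cong inj₁ (P.≼-antisym x y p q)
    a⊎ (inj₂ x) (inj₂ y) p q = cong inj₂ (Q.≼-antisym x y p q)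
    a⊎ (inj₁ _) (inj₂ _) _ ()
    a⊎ (inj₂ _) (inj₁ _) () _

    t⊎ : ∀ a b c → a ≼⊎ b → b ≼⊎ c → a ≼⊎ c
    t⊎ (inj₁ x) (inj₁ y) (inj₁ z) p q = P.≼-trans x y z p q
    t⊎ (inj₂ x) (inj₂ y) (inj₂ z) p q = Q.≼-trans x y z p q
    t⊎ (inj₁ _) _ (inj₂ _) _ _ = tt
    t⊎ (inj₁ _) (inj₂ _) (inj₁ _) _ ()
    t⊎ (inj₂ _) (inj₁ _) _ () _
    t⊎ (inj₂ _) (inj₂ _) (inj₁ _) _ ()

  _⊕_ : FinPoset
  _⊕_ = record
    { size = P.size ℕ.+ Q.size
    ; _≼_ = λ i j → splitAt P.size i ≼⊎ splitAt P.size j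
    ; ≼-refl = λ i → r⊎ (splitAt P.size i)
    ; ≼-antisym = λ i j p q →
        trans (sym (join-splitAt P.size Q.size i))
          (trans (cong (join P.size Q.size) (a⊎ (splitAt P.size i) (splitAt P.size j) p q))
                 (join-splitAt P.size Q.size j))
    ; ≼-trans = λ i j k → t⊎ (splitAt P.size i) (splitAt P.size j) (splitAt P.size k) }

module _ (P : FinPoset) where
  open FinPoset P

  IsUpperIdeal : (Fin size → Bool) → Set
  IsUpperIdeal I = ∀ x y → I y ≡ true → y ≼ x → I x ≡ true

  indicator : Bool → ℚ
  indicator true  = 1ℚ
  indicator false = 0ℚ

  -- u ∈ O_P : u is a convex combination Σ λₖ χ_{Iₖ} of indicator vectors
  -- of upper order ideals Iₖ (λₖ ≥ 0, Σ λₖ = 1).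
  InOrderPolytope : (Fin size → ℚ) → Set
  InOrderPolytope u =
    Σ (List (ℚ × (Fin size → Bool))) λ comb →
        All (λ c → (0ℚ ℚ.≤ proj₁ c) × IsUpperIdeal (proj₂ c)) comb
      × (foldr ℚ._+_ 0ℚ (map proj₁ comb) ≡ 1ℚ)
      × (∀ i → u i ≡ foldr ℚ._+_ 0ℚ (map (λ c → proj₁ c ℚ.* indicator (proj₂ c i)) comb))

  LatticePoint : Set
  LatticePoint = Σ (Fin size → ℤ) λ u → InOrderPolytope (λ i → u i ℚ./ 1)

record FiniteField (q : ℕ) : Set₁ where
  field
    commRing : CommutativeRing 0ℓ 0ℓ
  open CommutativeRing commRing public
  field
    _≟_     : Decidable _≈_
    1≉0     : ¬ (1# ≈ 0#)
    _⁻¹     : Carrier → Carrier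
    ⁻¹-inverse : ∀ x → ¬ (x ≈ 0#) → x * (x ⁻¹) ≈ 1#
    enum      : Fin q → Carrier
    enum-inj  : ∀ i j → enum i ≈ enum j → i ≡ j
    enum-surj : ∀ x → ∃ λ i → enum i ≈ x

allFuns : (q n : ℕ) → List (Fin n → Fin q)
allFuns q zero    = (λ ()) ∷ []
allFuns q (suc n) =
  concatMap (λ a → map (λ f → λ { Fin.zero → a ; (Fin.suc i) → f i }) (allFuns q n))
            (allFin q)

module Toric {q : ℕ} (F : FiniteField q) (P : FinPoset) where
  open FiniteField F
  open FinPoset P using (size)
  open import Algebra.Definitions.RawSemiring (Algebra.Bundles.Semiring.rawSemiring semiring) using () renaming (_^_ to _^ᴿ_)

  -- x ^ u for u ∈ ℤ (meaningful for x ≠ 0)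
  _^ℤ_ : Carrier → ℤ → Carrier
  x ^ℤ (+ k)     = x ^ᴿ k
  x ^ℤ -[1+ k ]  = (x ⁻¹) ^ᴿ suc k

  monomial : (Fin size → Carrier) → (Fin size → ℤ) → Carrier
  monomial t u = foldr _*_ 1# (map (λ i → t i ^ℤ u i) (allFin size))

  -- an element of L_P, written as a finite sum Σ cₖ x^{uₖ} with uₖ ∈ O_P ∩ ℤⁿ
  LP : Set
  LP = List (Carrier × LatticePoint P)

  eval : LP → (Fin size → Carrier) → Carrier
  eval f t = foldr _+_ 0# (map (λ c → proj₁ c * monomial t (proj₁ (proj₂ c))) f)

  coeff : LP → (Fin size → ℤ) → Carrier
  coeff f v = foldr _+_ 0# (map proj₁
                (filter (λ c → all? (λ i → proj₁ (proj₂ c) i ℤ.≟ v i)) f))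

  -- f ≠ 0 as a Laurent polynomial
  NonZeroPoly : LP → Set
  NonZeroPoly f = ∃ λ v → ¬ (coeff f v ≈ 0#)

  Z : LP → ℕ
  Z f = length (filter
          (λ s → all? (λ i → ¬? (enum (s i) ≟ 0#)) ×-dec (eval f (λ i → enum (s i)) ≟ 0#))
          (allFuns q size))

  IsMinimumDistance : ℕ → Set
  IsMinimumDistance d =
    ∃ λ M → (∃ λ f → NonZeroPoly f × Z f ≡ M)
          × (∀ f → NonZeroPoly f → Z f ≤ M)
          × d ≡ (q ∸ 1) ^ size ∸ M

-- For P = Aₘ ⊕ Aₘ the lattice points of O_P are indicator vectors of upper sets, so in the
-- variables x of the lower antichain and y of the upper one every f ∈ L_P has the shape
-- g(y) + y₁⋯yₘ·h(x) with g, h multilinear.  A nonzero multilinear polynomial in n variables has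
-- at most (q−1)ⁿ − (q−2)ⁿ zeros on the torus: fix the first variable to c; at most one fibre
-- vanishes identically, and the others are handled by induction.  If g is not a multiple of
-- y₁⋯yₘ, then f(x, ·) is nonzero for every x; otherwise f = y₁⋯yₘ·h′(x) with h′ ≠ 0.  Either way
-- f has at most (q−1)ᵐ((q−1)ᵐ − (q−2)ᵐ) zeros, with equality for f = ∏ⱼ(yⱼ − 1), so the
-- minimum distance is (q−1)²ᵐ minus this number, i.e. (q−1)ᵐ(q−2)ᵐ.

module Submission where

open import Level using (0ℓ)
open import Data.Nat as ℕ using (ℕ; zero; suc; _≤_; _^_; _∸_)
import Data.Nat.Properties as ℕP
open import Data.Nat.Tactic.RingSolver using (solve-∀)
open import Data.Fin as Fin using (Fin; splitAt)
import Data.Vec.Functional as Vector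
open import Data.Fin.Properties as FinP using (all?)
open import Data.Integer as ℤ using (ℤ; +_; -[1+_])
import Data.Integer.Properties as ℤP
open import Data.Rational as ℚ using (ℚ; 0ℚ; 1ℚ; ↥_; ↧_)
import Data.Rational.Properties as ℚP
import Data.Nat.GCD as GCD
open import Data.Bool using (Bool; true; false; if_then_else_)
open import Data.List using (List; []; _∷_; _++_; map; filter; length; foldr; tabulate; allFin; concatMap)
import Data.List.Properties as ListP
open import Data.Product using (∃; _×_; _,_; proj₁; proj₂)
open import Data.Sum using (_⊎_; inj₁; inj₂; [_,_])
open import Data.Empty using (⊥-elim)
open import Data.Unit using (⊤; tt)
open import Function using (id; _∘_; _⇔_; mk⇔)
open import Relation.Nullary using (¬_; Dec; yes; no; does)
open import Relation.Binary using (Setoid)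
open import Relation.Nullary.Decidable using (does-⇔; _×-dec_; _⊎-dec_; ¬?)
open import Relation.Unary using (Decidable; _⊆_)
open import Data.List.Relation.Unary.All as All using (All; []; _∷_)
open import Relation.Binary.PropositionalEquality as ≡ using (_≡_; _≗_)
open import Algebra.Properties.Semiring.Sum ℕP.+-*-semiring using (sum; sum-cong-≗; *-distribˡ-sum)

open import Defs

-- Counting over a finite field

if-does-⇔ : ∀ {a b} {A : Set a} {B : Set b} {X : Set} {x y : X} → A ⇔ B →
            (a? : Dec A) (b? : Dec B) →
            (if does a? then x else y) ≡ (if does b? then x else y)
if-does-⇔ {x = x} {y} A⇔B a? b? = ≡.cong (λ b → if b then x else y) (does-⇔ A⇔B a? b?)

sum-mono : ∀ {n} {f g : Fin n → ℕ} → (∀ i → f i ≤ g i) → sum f ≤ sum g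
sum-mono {zero}  f≤g = ℕ.z≤n
sum-mono {suc n} f≤g = ℕP.+-mono-≤ (f≤g Fin.zero) (sum-mono (f≤g ∘ Fin.suc))

sum-+ : ∀ {n} (f g : Fin n → ℕ) → sum (λ i → f i ℕ.+ g i) ≡ sum f ℕ.+ sum g
sum-+ {zero}  f g = ≡.refl
sum-+ {suc n} f g = ≡.trans (≡.cong (f Fin.zero ℕ.+ g Fin.zero ℕ.+_) (sum-+ (λ i → f (Fin.suc i)) (λ i → g (Fin.suc i))))
                            (interchange (f Fin.zero) (g Fin.zero) _ _)
  where
  interchange : ∀ a b c d → (a ℕ.+ b) ℕ.+ (c ℕ.+ d) ≡ (a ℕ.+ c) ℕ.+ (b ℕ.+ d)
  interchange = solve-∀

sum-δ : ∀ {n} (i : Fin n) → sum (λ j → if does (j Fin.≟ i) then 1 else 0) ≡ 1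
sum-δ {suc n} Fin.zero = ≡.cong suc (sum-zero n)
  where
  sum-zero : ∀ n → sum {n} (λ _ → 0) ≡ 0
  sum-zero zero    = ≡.refl
  sum-zero (suc n) = sum-zero n
sum-δ {suc n} (Fin.suc i) =
  ≡.trans (sum-cong-≗ (λ j → if-does-⇔ (mk⇔ FinP.suc-injective (≡.cong Fin.suc)) (Fin.suc j Fin.≟ Fin.suc i) (j Fin.≟ i)))
          (sum-δ i)

module UnitSums {q : ℕ} (F : FiniteField q) where
  open FiniteField F hiding (zero)

  unitsOnly : Carrier → ℕ → ℕ
  unitsOnly c k = if does (c ≟ 0#) then 0 else k

  ∑* : (Carrier → ℕ) → ℕ
  ∑* g = sum (λ a → unitsOnly (enum a) (g (enum a)))

  module _ {g h : Carrier → ℕ} where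

    ∑*-cong : (∀ c → ¬ c ≈ 0# → g c ≡ h c) → ∑* g ≡ ∑* h
    ∑*-cong g≡h = sum-cong-≗ (λ a → pointwise (enum a))
      where
      pointwise : ∀ c → unitsOnly c (g c) ≡ unitsOnly c (h c)
      pointwise c with c ≟ 0#
      ... | yes _  = ≡.refl
      ... | no c≉0 = g≡h c c≉0

    ∑*-mono : (∀ c → ¬ c ≈ 0# → g c ≤ h c) → ∑* g ≤ ∑* h
    ∑*-mono g≤h = sum-mono (λ a → pointwise (enum a))
      where
      pointwise : ∀ c → unitsOnly c (g c) ≤ unitsOnly c (h c)
      pointwise c with c ≟ 0#
      ... | yes _  = ℕ.z≤n
      ... | no c≉0 = g≤h c c≉0

    ∑*-+ : ∑* (λ c → g c ℕ.+ h c) ≡ ∑* g ℕ.+ ∑* h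
    ∑*-+ = ≡.trans (sum-cong-≗ (λ a → pointwise (enum a))) (sum-+ {q} _ _)
      where
      pointwise : ∀ c → unitsOnly c (g c ℕ.+ h c) ≡ unitsOnly c (g c) ℕ.+ unitsOnly c (h c)
      pointwise c with c ≟ 0#
      ... | yes _ = ≡.refl
      ... | no _  = ≡.refl

  ∑*-*ˡ : ∀ k (g : Carrier → ℕ) → ∑* (λ c → k ℕ.* g c) ≡ k ℕ.* ∑* g
  ∑*-*ˡ k g = ≡.trans (sum-cong-≗ (λ a → pointwise (enum a))) (≡.sym (*-distribˡ-sum {q} k _))
    where
    pointwise : ∀ c → unitsOnly c (k ℕ.* g c) ≡ k ℕ.* unitsOnly c (g c)
    pointwise c with c ≟ 0#
    ... | yes _ = ≡.sym (ℕP.*-zeroʳ k)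
    ... | no _  = ≡.refl

  q₋₁ : ℕ
  q₋₁ = ∑* (λ _ → 1)

  q₋₂ : ℕ
  q₋₂ = ∑* (λ c → if does (c ≟ 1#) then 0 else 1)

  ∑*-const : ∀ k → ∑* (λ _ → k) ≡ k ℕ.* q₋₁
  ∑*-const k = ≡.trans (∑*-cong (λ _ _ → ≡.sym (ℕP.*-identityʳ k))) (∑*-*ˡ k (λ _ → 1))

  count-enum : ∀ c → sum (λ a → if does (enum a ≟ c) then 1 else 0) ≡ 1
  count-enum c with enum-surj c
  ... | i , enum-i≈c = ≡.trans (sum-cong-≗ (λ a → if-does-⇔ (enum≈c⇔≡i a) (enum a ≟ c) (a Fin.≟ i))) (sum-δ i)
    where
    enum≈c⇔≡i : ∀ a → enum a ≈ c ⇔ a ≡ i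
    enum≈c⇔≡i a = mk⇔ (λ e → enum-inj a i (trans e (sym enum-i≈c)))
                      (λ { ≡.refl → enum-i≈c })

  private
    if-then-0 : ∀ b X → (if b then X else 0) ≡ X ℕ.* (if b then 1 else 0)
    if-then-0 true  X = ≡.sym (ℕP.*-identityʳ X)
    if-then-0 false X = ≡.sym (ℕP.*-zeroʳ X)

    if-else-0 : ∀ b Y → (if b then 0 else Y) ≡ Y ℕ.* (if b then 0 else 1)
    if-else-0 true  Y = ≡.sym (ℕP.*-zeroʳ Y)
    if-else-0 false Y = ≡.sym (ℕP.*-identityʳ Y)

    if-split : ∀ b X Y → (if b then X else Y) ≡ (if b then X else 0) ℕ.+ (if b then 0 else Y)
    if-split true  X Y = ≡.sym (ℕP.+-identityʳ X)
    if-split false X Y = ≡.refl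

    if-same : ∀ b (X : ℕ) → X ≡ (if b then X else X)
    if-same true  X = ≡.refl
    if-same false X = ≡.refl

  sum-enum-indicator : ∀ c X → sum (λ a → if does (enum a ≟ c) then X else 0) ≡ X
  sum-enum-indicator c X = begin
    sum (λ a → if does (enum a ≟ c) then X else 0)             ≡⟨ sum-cong-≗ (λ a → if-then-0 (does (enum a ≟ c)) X) ⟩
    sum (λ a → X ℕ.* (if does (enum a ≟ c) then 1 else 0))     ≡⟨ *-distribˡ-sum {q} X _ ⟨
    X ℕ.* sum (λ a → if does (enum a ≟ c) then 1 else 0)       ≡⟨ ≡.cong (X ℕ.*_) (count-enum c) ⟩
    X ℕ.* 1                                                    ≡⟨ ℕP.*-identityʳ X ⟩
    X                                                          ∎
    where open ≡.≡-Reasoning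

  ∑*-indicator-≤ : ∀ c₀ X → ∑* (λ c → if does (c ≟ c₀) then X else 0) ≤ X
  ∑*-indicator-≤ c₀ X = ℕP.≤-trans (sum-mono (λ a → unitsOnly-≤ (enum a) (if does (enum a ≟ c₀) then X else 0)))
                                  (ℕP.≤-reflexive (sum-enum-indicator c₀ X))
    where
    unitsOnly-≤ : ∀ c k → unitsOnly c k ≤ k
    unitsOnly-≤ c k with c ≟ 0#
    ... | yes _ = ℕ.z≤n
    ... | no _  = ℕP.≤-refl

  ∑*-split-at-1 : ∀ X Y → ∑* (λ c → if does (c ≟ 1#) then X else Y) ≡ X ℕ.+ Y ℕ.* q₋₂
  ∑*-split-at-1 X Y = begin
    ∑* (choose X Y)                                 ≡⟨ ∑*-cong {h = λ c → choose X 0 c ℕ.+ choose 0 Y c} split ⟩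
    ∑* (λ c → choose X 0 c ℕ.+ choose 0 Y c)        ≡⟨ ∑*-+ {choose X 0} {choose 0 Y} ⟩
    ∑* (choose X 0) ℕ.+ ∑* (choose 0 Y)             ≡⟨ ≡.cong₂ ℕ._+_ at-1 off-1 ⟩
    X ℕ.+ Y ℕ.* q₋₂                                 ∎
    where
    open ≡.≡-Reasoning
    choose : ℕ → ℕ → Carrier → ℕ
    choose X Y c = if does (c ≟ 1#) then X else Y
    split : ∀ c → ¬ c ≈ 0# → choose X Y c ≡ choose X 0 c ℕ.+ choose 0 Y c
    split c _ = if-split (does (c ≟ 1#)) X Y
    unit-at-1 : ∀ c → unitsOnly c (choose X 0 c) ≡ choose X 0 c
    unit-at-1 c with c ≟ 0# | c ≟ 1#
    ... | yes c≈0 | yes c≈1 = ⊥-elim (1≉0 (trans (sym c≈1) c≈0))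
    ... | yes _   | no _    = ≡.refl
    ... | no _    | _       = ≡.refl
    at-1 : ∑* (choose X 0) ≡ X
    at-1 = ≡.trans (sum-cong-≗ (λ a → unit-at-1 (enum a))) (sum-enum-indicator 1# X)
    off-1 : ∑* (choose 0 Y) ≡ Y ℕ.* q₋₂
    off-1 = ≡.trans (∑*-cong {h = λ c → Y ℕ.* choose 0 1 c} (λ c _ → if-else-0 (does (c ≟ 1#)) Y)) (∑*-*ˡ Y (choose 0 1))

  q₋₁≡1+q₋₂ : q₋₁ ≡ suc q₋₂
  q₋₁≡1+q₋₂ = begin
    ∑* (λ _ → 1)                                ≡⟨ ∑*-cong {h = λ c → if does (c ≟ 1#) then 1 else 1} (λ c _ → if-same _ 1) ⟩
    ∑* (λ c → if does (c ≟ 1#) then 1 else 1)   ≡⟨ ∑*-split-at-1 1 1 ⟩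
    1 ℕ.+ 1 ℕ.* q₋₂                             ≡⟨ ≡.cong suc (ℕP.*-identityˡ q₋₂) ⟩
    suc q₋₂                                     ∎
    where open ≡.≡-Reasoning

  q≡1+q₋₁ : q ≡ suc q₋₁
  q≡1+q₋₁ = begin
    q                                                                         ≡⟨ sum-1 q ⟨
    sum {q} (λ _ → 1)
      ≡⟨ sum-cong-≗ (λ a → ≡.trans (if-same (does (enum a ≟ 0#)) 1) (if-split (does (enum a ≟ 0#)) 1 1)) ⟩
    sum (λ a → (if does (enum a ≟ 0#) then 1 else 0) ℕ.+ unitsOnly (enum a) 1) ≡⟨ sum-+ {q} _ _ ⟩
    sum (λ a → if does (enum a ≟ 0#) then 1 else 0) ℕ.+ q₋₁                   ≡⟨ ≡.cong (ℕ._+ q₋₁) (count-enum 0#) ⟩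
    suc q₋₁                                                                   ∎
    where
    open ≡.≡-Reasoning
    sum-1 : ∀ n → sum {n} (λ _ → 1) ≡ n
    sum-1 zero    = ≡.refl
    sum-1 (suc n) = ≡.cong suc (sum-1 n)

-- Multilinear polynomials

module FieldFacts {q : ℕ} (F : FiniteField q) where
  open FiniteField F hiding (zero)
  open import Algebra.Properties.Group +-group using (inverseʳ-unique)
  open import Relation.Binary.Reasoning.Setoid setoid

  nonzero*x≈0⇒x≈0 : ∀ c x → ¬ c ≈ 0# → c * x ≈ 0# → x ≈ 0#
  nonzero*x≈0⇒x≈0 c x c≉0 cx≈0 = begin
    x                ≈⟨ *-identityˡ x ⟨
    1# * x           ≈⟨ *-cong (trans (sym (⁻¹-inverse c c≉0)) (*-comm c _)) refl ⟩
    (c ⁻¹ * c) * x   ≈⟨ *-assoc _ c x ⟩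
    c ⁻¹ * (c * x)   ≈⟨ *-cong refl cx≈0 ⟩
    c ⁻¹ * 0#        ≈⟨ zeroʳ _ ⟩
    0#               ∎

  linear-root : ∀ a b c → ¬ b ≈ 0# → a + c * b ≈ 0# → c ≈ - a * b ⁻¹
  linear-root a b c b≉0 a+cb≈0 = begin
    c                ≈⟨ *-identityʳ c ⟨
    c * 1#           ≈⟨ *-cong refl (⁻¹-inverse b b≉0) ⟨
    c * (b * b ⁻¹)   ≈⟨ *-assoc c b _ ⟨
    (c * b) * b ⁻¹   ≈⟨ *-cong (inverseʳ-unique a (c * b) a+cb≈0) refl ⟩
    - a * b ⁻¹       ∎

module MultilinearPolynomials {q : ℕ} (F : FiniteField q) where
  open FiniteField F hiding (zero)
  open UnitSums F
  open FieldFacts F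
  open import Algebra.Properties.Group +-group using (inverseʳ-unique; ⁻¹-involutive)
  import Relation.Binary.Reasoning.Setoid setoid as ≈-Reasoning
  import Algebra.Properties.CommutativeSemigroup as CommSemigroupProps
  open CommSemigroupProps +-commutativeSemigroup using () renaming (interchange to +-interchange)
  open CommSemigroupProps *-commutativeSemigroup using () renaming (x∙yz≈y∙xz to *-left-comm)

  -- node p₀ p₁ stands for p₀ + x₀ p₁, where x₀ is the first of the variables.
  data Multilinear : ℕ → Set where
    leaf : Carrier → Multilinear zero
    node : ∀ {n} → Multilinear n → Multilinear n → Multilinear (suc n)

  private variable
    n : ℕ
    p p′ p₀ p₁ r r′ s : Multilinear n

  0ᴹ : Multilinear n
  0ᴹ {zero}  = leaf 0#
  0ᴹ {suc n} = node 0ᴹ 0ᴹ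

  infixl 6 _+ᴹ_
  infixl 7 _·ᴹ_

  _+ᴹ_ : Multilinear n → Multilinear n → Multilinear n
  leaf a     +ᴹ leaf b     = leaf (a + b)
  node p₀ p₁ +ᴹ node r₀ r₁ = node (p₀ +ᴹ r₀) (p₁ +ᴹ r₁)

  _·ᴹ_ : Carrier → Multilinear n → Multilinear n
  c ·ᴹ leaf a     = leaf (c * a)
  c ·ᴹ node p₀ p₁ = node (c ·ᴹ p₀) (c ·ᴹ p₁)

  infix 4 _≈ᴹ_
  data _≈ᴹ_ : Multilinear n → Multilinear n → Set where
    leaf : ∀ {a b} → a ≈ b → leaf a ≈ᴹ leaf b
    node : ∀ {p₀ p₁ r₀ r₁ : Multilinear n} → p₀ ≈ᴹ r₀ → p₁ ≈ᴹ r₁ → node p₀ p₁ ≈ᴹ node r₀ r₁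

  ≈ᴹ-refl : p ≈ᴹ p
  ≈ᴹ-refl {p = leaf a}     = leaf refl
  ≈ᴹ-refl {p = node p₀ p₁} = node ≈ᴹ-refl ≈ᴹ-refl

  ≈ᴹ-reflexive : p ≡ r → p ≈ᴹ r
  ≈ᴹ-reflexive ≡.refl = ≈ᴹ-refl

  ≈ᴹ-sym : p ≈ᴹ r → r ≈ᴹ p
  ≈ᴹ-sym (leaf e)     = leaf (sym e)
  ≈ᴹ-sym (node e₀ e₁) = node (≈ᴹ-sym e₀) (≈ᴹ-sym e₁)

  ≈ᴹ-trans : p ≈ᴹ r → r ≈ᴹ s → p ≈ᴹ s
  ≈ᴹ-trans (leaf e)     (leaf f)     = leaf (trans e f)
  ≈ᴹ-trans (node e₀ e₁) (node f₀ f₁) = node (≈ᴹ-trans e₀ f₀) (≈ᴹ-trans e₁ f₁)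

  ≈ᴹ-setoid : ℕ → Setoid 0ℓ 0ℓ
  ≈ᴹ-setoid n = record
    { Carrier       = Multilinear n
    ; _≈_           = _≈ᴹ_
    ; isEquivalence = record { refl = ≈ᴹ-refl ; sym = ≈ᴹ-sym ; trans = ≈ᴹ-trans }
    }

  +ᴹ-cong : p ≈ᴹ p′ → r ≈ᴹ r′ → p +ᴹ r ≈ᴹ p′ +ᴹ r′
  +ᴹ-cong (leaf e)     (leaf f)     = leaf (+-cong e f)
  +ᴹ-cong (node e₀ e₁) (node f₀ f₁) = node (+ᴹ-cong e₀ f₀) (+ᴹ-cong e₁ f₁)

  ·ᴹ-cong : ∀ {c d} → c ≈ d → p ≈ᴹ r → c ·ᴹ p ≈ᴹ d ·ᴹ r
  ·ᴹ-cong c≈d (leaf e)     = leaf (*-cong c≈d e)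
  ·ᴹ-cong c≈d (node e₀ e₁) = node (·ᴹ-cong c≈d e₀) (·ᴹ-cong c≈d e₁)

  +ᴹ-identityˡ : ∀ (p : Multilinear n) → 0ᴹ +ᴹ p ≈ᴹ p
  +ᴹ-identityˡ (leaf a)     = leaf (+-identityˡ a)
  +ᴹ-identityˡ (node p₀ p₁) = node (+ᴹ-identityˡ p₀) (+ᴹ-identityˡ p₁)

  +ᴹ-identityʳ : ∀ (p : Multilinear n) → p +ᴹ 0ᴹ ≈ᴹ p
  +ᴹ-identityʳ (leaf a)     = leaf (+-identityʳ a)
  +ᴹ-identityʳ (node p₀ p₁) = node (+ᴹ-identityʳ p₀) (+ᴹ-identityʳ p₁)

  +ᴹ-comm : ∀ (p r : Multilinear n) → p +ᴹ r ≈ᴹ r +ᴹ p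
  +ᴹ-comm (leaf a)     (leaf b)     = leaf (+-comm a b)
  +ᴹ-comm (node p₀ p₁) (node r₀ r₁) = node (+ᴹ-comm p₀ r₀) (+ᴹ-comm p₁ r₁)

  +ᴹ-assoc : ∀ (p r s : Multilinear n) → (p +ᴹ r) +ᴹ s ≈ᴹ p +ᴹ (r +ᴹ s)
  +ᴹ-assoc (leaf a)     (leaf b)     (leaf c)     = leaf (+-assoc a b c)
  +ᴹ-assoc (node p₀ p₁) (node r₀ r₁) (node s₀ s₁) = node (+ᴹ-assoc p₀ r₀ s₀) (+ᴹ-assoc p₁ r₁ s₁)

  ·ᴹ-zeroʳ : ∀ c → c ·ᴹ 0ᴹ {n} ≈ᴹ 0ᴹ
  ·ᴹ-zeroʳ {zero}  c = leaf (zeroʳ c)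
  ·ᴹ-zeroʳ {suc n} c = node (·ᴹ-zeroʳ c) (·ᴹ-zeroʳ c)

  ·ᴹ-assoc : ∀ c d (p : Multilinear n) → c ·ᴹ (d ·ᴹ p) ≈ᴹ (c * d) ·ᴹ p
  ·ᴹ-assoc c d (leaf a)     = leaf (sym (*-assoc c d a))
  ·ᴹ-assoc c d (node p₀ p₁) = node (·ᴹ-assoc c d p₀) (·ᴹ-assoc c d p₁)

  ·ᴹ-distribˡ : ∀ c (p r : Multilinear n) → c ·ᴹ (p +ᴹ r) ≈ᴹ c ·ᴹ p +ᴹ c ·ᴹ r
  ·ᴹ-distribˡ c (leaf a)     (leaf b)     = leaf (distribˡ c a b)
  ·ᴹ-distribˡ c (node p₀ p₁) (node r₀ r₁) = node (·ᴹ-distribˡ c p₀ r₀) (·ᴹ-distribˡ c p₁ r₁)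

  ·ᴹ-distribʳ : ∀ c d (p : Multilinear n) → c ·ᴹ p +ᴹ d ·ᴹ p ≈ᴹ (c + d) ·ᴹ p
  ·ᴹ-distribʳ c d (leaf a)     = leaf (sym (distribʳ a c d))
  ·ᴹ-distribʳ c d (node p₀ p₁) = node (·ᴹ-distribʳ c d p₀) (·ᴹ-distribʳ c d p₁)

  _[x₀≔_] : Multilinear (suc n) → Carrier → Multilinear n
  node p₀ p₁ [x₀≔ c ] = p₀ +ᴹ c ·ᴹ p₁

  [x₀≔]-cong : ∀ {c d} → c ≈ d → p ≈ᴹ r → p [x₀≔ c ] ≈ᴹ r [x₀≔ d ]
  [x₀≔]-cong c≈d (node e₀ e₁) = +ᴹ-cong e₀ (·ᴹ-cong c≈d e₁)

  ·ᴹ-[x₀≔] : ∀ c d (p : Multilinear (suc n)) → (d ·ᴹ p) [x₀≔ c ] ≈ᴹ d ·ᴹ (p [x₀≔ c ])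
  ·ᴹ-[x₀≔] c d (node p₀ p₁) = ≈ᴹ-trans (+ᴹ-cong (≈ᴹ-refl {p = d ·ᴹ p₀}) commute)
                                       (≈ᴹ-sym (·ᴹ-distribˡ d p₀ (c ·ᴹ p₁)))
    where
    commute : c ·ᴹ (d ·ᴹ p₁) ≈ᴹ d ·ᴹ (c ·ᴹ p₁)
    commute = ≈ᴹ-trans (·ᴹ-assoc c d p₁) (≈ᴹ-trans (·ᴹ-cong (*-comm c d) ≈ᴹ-refl) (≈ᴹ-sym (·ᴹ-assoc d c p₁)))

  ⟦_⟧ : Multilinear n → (Fin n → Carrier) → Carrier
  ⟦ leaf a     ⟧ τ = a
  ⟦ node p₀ p₁ ⟧ τ = ⟦ p₀ ⟧ (τ ∘ Fin.suc) + τ Fin.zero * ⟦ p₁ ⟧ (τ ∘ Fin.suc)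

  ⟦⟧-cong : ∀ {τ σ : Fin n → Carrier} → p ≈ᴹ r → (∀ i → τ i ≈ σ i) → ⟦ p ⟧ τ ≈ ⟦ r ⟧ σ
  ⟦⟧-cong (leaf e)     τ≈σ = e
  ⟦⟧-cong (node e₀ e₁) τ≈σ = +-cong (⟦⟧-cong e₀ (τ≈σ ∘ Fin.suc)) (*-cong (τ≈σ Fin.zero) (⟦⟧-cong e₁ (τ≈σ ∘ Fin.suc)))

  ⟦0ᴹ⟧ : ∀ τ → ⟦ 0ᴹ {n} ⟧ τ ≈ 0#
  ⟦0ᴹ⟧ {zero}  τ = refl
  ⟦0ᴹ⟧ {suc n} τ = begin
    ⟦ 0ᴹ {n} ⟧ τ′ + τ Fin.zero * ⟦ 0ᴹ {n} ⟧ τ′  ≈⟨ +-cong (⟦0ᴹ⟧ τ′) (*-cong refl (⟦0ᴹ⟧ τ′)) ⟩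
    0# + τ Fin.zero * 0#                      ≈⟨ +-identityˡ _ ⟩
    τ Fin.zero * 0#                           ≈⟨ zeroʳ _ ⟩
    0#                                        ∎
    where
    open ≈-Reasoning
    τ′ = τ ∘ Fin.suc

  ⟦+ᴹ⟧ : ∀ (p r : Multilinear n) τ → ⟦ p +ᴹ r ⟧ τ ≈ ⟦ p ⟧ τ + ⟦ r ⟧ τ
  ⟦+ᴹ⟧ (leaf a)     (leaf b)     τ = refl
  ⟦+ᴹ⟧ (node p₀ p₁) (node r₀ r₁) τ = begin
    ⟦ p₀ +ᴹ r₀ ⟧ τ′ + x * ⟦ p₁ +ᴹ r₁ ⟧ τ′               ≈⟨ +-cong (⟦+ᴹ⟧ p₀ r₀ τ′) (*-cong refl (⟦+ᴹ⟧ p₁ r₁ τ′)) ⟩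
    (⟦ p₀ ⟧ τ′ + ⟦ r₀ ⟧ τ′) + x * (⟦ p₁ ⟧ τ′ + ⟦ r₁ ⟧ τ′) ≈⟨ +-cong refl (distribˡ x _ _) ⟩
    (⟦ p₀ ⟧ τ′ + ⟦ r₀ ⟧ τ′) + (x * ⟦ p₁ ⟧ τ′ + x * ⟦ r₁ ⟧ τ′) ≈⟨ +-interchange _ _ _ _ ⟩
    (⟦ p₀ ⟧ τ′ + x * ⟦ p₁ ⟧ τ′) + (⟦ r₀ ⟧ τ′ + x * ⟦ r₁ ⟧ τ′) ∎
    where
    open ≈-Reasoning
    τ′ = τ ∘ Fin.suc
    x = τ Fin.zero

  ⟦·ᴹ⟧ : ∀ c (p : Multilinear n) τ → ⟦ c ·ᴹ p ⟧ τ ≈ c * ⟦ p ⟧ τ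
  ⟦·ᴹ⟧ c (leaf a)     τ = refl
  ⟦·ᴹ⟧ c (node p₀ p₁) τ = begin
    ⟦ c ·ᴹ p₀ ⟧ τ′ + x * ⟦ c ·ᴹ p₁ ⟧ τ′  ≈⟨ +-cong (⟦·ᴹ⟧ c p₀ τ′) (*-cong refl (⟦·ᴹ⟧ c p₁ τ′)) ⟩
    c * ⟦ p₀ ⟧ τ′ + x * (c * ⟦ p₁ ⟧ τ′)  ≈⟨ +-cong refl (*-left-comm x c _) ⟩
    c * ⟦ p₀ ⟧ τ′ + c * (x * ⟦ p₁ ⟧ τ′)  ≈⟨ distribˡ c _ _ ⟨
    c * (⟦ p₀ ⟧ τ′ + x * ⟦ p₁ ⟧ τ′)      ∎
    where
    open ≈-Reasoning
    τ′ = τ ∘ Fin.suc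
    x = τ Fin.zero

  data IsZeroᴹ : Multilinear n → Set where
    leaf : ∀ {a} → a ≈ 0# → IsZeroᴹ (leaf a)
    node : IsZeroᴹ p₀ → IsZeroᴹ p₁ → IsZeroᴹ (node p₀ p₁)

  data NonZeroᴹ : Multilinear n → Set where
    leaf  : ∀ {a} → ¬ a ≈ 0# → NonZeroᴹ (leaf a)
    node₀ : NonZeroᴹ p₀ → NonZeroᴹ (node p₀ p₁)
    node₁ : NonZeroᴹ p₁ → NonZeroᴹ (node p₀ p₁)

  isZero? : ∀ (p : Multilinear n) → IsZeroᴹ p ⊎ NonZeroᴹ p
  isZero? (leaf a) with a ≟ 0#
  ... | yes a≈0 = inj₁ (leaf a≈0)
  ... | no a≉0  = inj₂ (leaf a≉0)
  isZero? (node p₀ p₁) with isZero? p₀ | isZero? p₁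
  ... | inj₂ p₀≠0 | _         = inj₂ (node₀ p₀≠0)
  ... | inj₁ _    | inj₂ p₁≠0 = inj₂ (node₁ p₁≠0)
  ... | inj₁ p₀≡0 | inj₁ p₁≡0 = inj₁ (node p₀≡0 p₁≡0)

  IsZero⇒¬NonZero : IsZeroᴹ p → ¬ NonZeroᴹ p
  IsZero⇒¬NonZero (leaf a≈0)     (leaf a≉0)  = a≉0 a≈0
  IsZero⇒¬NonZero (node p₀≡0 _)  (node₀ p₀≠0) = IsZero⇒¬NonZero p₀≡0 p₀≠0
  IsZero⇒¬NonZero (node _ p₁≡0)  (node₁ p₁≠0) = IsZero⇒¬NonZero p₁≡0 p₁≠0

  IsZero-resp-≈ᴹ : p ≈ᴹ r → IsZeroᴹ p → IsZeroᴹ r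
  IsZero-resp-≈ᴹ (leaf e)     (leaf a≈0)        = leaf (trans (sym e) a≈0)
  IsZero-resp-≈ᴹ (node e₀ e₁) (node p₀≡0 p₁≡0) = node (IsZero-resp-≈ᴹ e₀ p₀≡0) (IsZero-resp-≈ᴹ e₁ p₁≡0)

  NonZero-resp-≈ᴹ : p ≈ᴹ r → NonZeroᴹ p → NonZeroᴹ r
  NonZero-resp-≈ᴹ (leaf e)     (leaf a≉0)   = leaf (λ b≈0 → a≉0 (trans e b≈0))
  NonZero-resp-≈ᴹ (node e₀ e₁) (node₀ p₀≠0) = node₀ (NonZero-resp-≈ᴹ e₀ p₀≠0)
  NonZero-resp-≈ᴹ (node e₀ e₁) (node₁ p₁≠0) = node₁ (NonZero-resp-≈ᴹ e₁ p₁≠0)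

  IsZero-0ᴹ : IsZeroᴹ (0ᴹ {n})
  IsZero-0ᴹ {zero}  = leaf refl
  IsZero-0ᴹ {suc n} = node IsZero-0ᴹ IsZero-0ᴹ

  IsZero⇒≈0ᴹ : IsZeroᴹ p → p ≈ᴹ 0ᴹ
  IsZero⇒≈0ᴹ (leaf a≈0)        = leaf a≈0
  IsZero⇒≈0ᴹ (node p₀≡0 p₁≡0) = node (IsZero⇒≈0ᴹ p₀≡0) (IsZero⇒≈0ᴹ p₁≡0)

  IsZero-·ᴹ : ∀ {c} (p : Multilinear n) → c ≈ 0# → IsZeroᴹ (c ·ᴹ p)
  IsZero-·ᴹ (leaf a)     c≈0 = leaf (trans (*-cong c≈0 refl) (zeroˡ a))
  IsZero-·ᴹ (node p₀ p₁) c≈0 = node (IsZero-·ᴹ p₀ c≈0) (IsZero-·ᴹ p₁ c≈0)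

  +ᴹ·ᴹ-IsZero : ∀ c (p : Multilinear n) → IsZeroᴹ r → p +ᴹ c ·ᴹ r ≈ᴹ p
  +ᴹ·ᴹ-IsZero c p r≡0 =
    ≈ᴹ-trans (+ᴹ-cong ≈ᴹ-refl (≈ᴹ-trans (·ᴹ-cong refl (IsZero⇒≈0ᴹ r≡0)) (·ᴹ-zeroʳ c))) (+ᴹ-identityʳ p)

  IsZero-+ᴹ·ᴹ : ∀ c → IsZeroᴹ p → IsZeroᴹ r → IsZeroᴹ (p +ᴹ c ·ᴹ r)
  IsZero-+ᴹ·ᴹ {p = p} c p≡0 r≡0 = IsZero-resp-≈ᴹ (≈ᴹ-sym (+ᴹ·ᴹ-IsZero c p r≡0)) p≡0

  IsZero-[x₀≔] : ∀ c → IsZeroᴹ p → IsZeroᴹ (p [x₀≔ c ])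
  IsZero-[x₀≔] c (node p₀≡0 p₁≡0) = IsZero-+ᴹ·ᴹ c p₀≡0 p₁≡0

  -- the number of zeros in (F*)ⁿ, counted one variable at a time
  zeros : Multilinear n → ℕ
  zeros (leaf a)     = if does (a ≟ 0#) then 1 else 0
  zeros (node p₀ p₁) = ∑* (λ c → zeros (node p₀ p₁ [x₀≔ c ]))

  zeros-cong : p ≈ᴹ r → zeros p ≡ zeros r
  zeros-cong {p = leaf a} {leaf b} (leaf a≈b) =
    if-does-⇔ (mk⇔ (trans (sym a≈b)) (trans a≈b)) (a ≟ 0#) (b ≟ 0#)
  zeros-cong (node e₀ e₁) = ∑*-cong (λ c _ → zeros-cong ([x₀≔]-cong {c = c} refl (node e₀ e₁)))

  zeros-≤ : ∀ (p : Multilinear n) → zeros p ≤ q₋₁ ^ n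
  zeros-≤ (leaf a) with a ≟ 0#
  ... | yes _ = ℕP.≤-refl
  ... | no _  = ℕ.z≤n
  zeros-≤ {suc n} p@(node _ _) = begin
    ∑* (λ c → zeros (p [x₀≔ c ])) ≤⟨ ∑*-mono (λ c _ → zeros-≤ (p [x₀≔ c ])) ⟩
    ∑* (λ _ → q₋₁ ^ n)            ≡⟨ ∑*-const (q₋₁ ^ n) ⟩
    q₋₁ ^ n ℕ.* q₋₁               ≡⟨ ℕP.*-comm (q₋₁ ^ n) q₋₁ ⟩
    q₋₁ ^ suc n                   ∎
    where open ℕP.≤-Reasoning

  zeros-IsZero : IsZeroᴹ p → zeros {n} p ≡ q₋₁ ^ n
  zeros-IsZero {n = zero} (leaf {a} a≈0) with a ≟ 0#
  ... | yes _  = ≡.refl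
  ... | no a≉0 = ⊥-elim (a≉0 a≈0)
  zeros-IsZero {n = suc n} {p = p@(node _ _)} p≡0 = begin
    ∑* (λ c → zeros (p [x₀≔ c ])) ≡⟨ ∑*-cong (λ c _ → zeros-IsZero (IsZero-[x₀≔] c p≡0)) ⟩
    ∑* (λ _ → q₋₁ ^ n)            ≡⟨ ∑*-const (q₋₁ ^ n) ⟩
    q₋₁ ^ n ℕ.* q₋₁               ≡⟨ ℕP.*-comm (q₋₁ ^ n) q₋₁ ⟩
    q₋₁ ^ suc n                   ∎
    where open ≡.≡-Reasoning

  zeros-·ᴹ : ∀ {d} (p : Multilinear n) → ¬ d ≈ 0# → zeros (d ·ᴹ p) ≡ zeros p
  zeros-·ᴹ {d = d} (leaf a) d≉0 =
    if-does-⇔ (mk⇔ (nonzero*x≈0⇒x≈0 d a d≉0) (λ a≈0 → trans (*-cong refl a≈0) (zeroʳ d))) ((d * a) ≟ 0#) (a ≟ 0#)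
  zeros-·ᴹ {d = d} p@(node _ _) d≉0 =
    ∑*-cong (λ c _ → ≡.trans (zeros-cong (·ᴹ-[x₀≔] c d p)) (zeros-·ᴹ (p [x₀≔ c ]) d≉0))

  root-unique : ∀ (p₀ p₁ : Multilinear n) → NonZeroᴹ p₁ →
                ∃ λ c₀ → ∀ c → IsZeroᴹ (node p₀ p₁ [x₀≔ c ]) → c ≈ c₀
  root-unique (leaf a) (leaf b) (leaf b≉0) = - a * b ⁻¹ , λ { c (leaf a+cb≈0) → linear-root a b c b≉0 a+cb≈0 }
  root-unique (node p₀ p₁) (node r₀ r₁) (node₀ r₀≠0) with root-unique p₀ r₀ r₀≠0
  ... | c₀ , only-root = c₀ , λ { c (node z₀ _) → only-root c z₀ }
  root-unique (node p₀ p₁) (node r₀ r₁) (node₁ r₁≠0) with root-unique p₁ r₁ r₁≠0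
  ... | c₀ , only-root = c₀ , λ { c (node _ z₁) → only-root c z₁ }

  at-most-one-root : ∀ (p : Multilinear (suc n)) → NonZeroᴹ p →
                     ∃ λ c₀ → ∀ c → IsZeroᴹ (p [x₀≔ c ]) → c ≈ c₀
  at-most-one-root (node p₀ p₁) p≠0 with isZero? p₁
  ... | inj₂ p₁≠0 = root-unique p₀ p₁ p₁≠0
  ... | inj₁ p₁≡0 = 0# , λ c z → ⊥-elim (IsZero⇒¬NonZero (IsZero-resp-≈ᴹ (+ᴹ·ᴹ-IsZero c p₀ p₁≡0) z) (p₀≠0 p≠0))
    where
    p₀≠0 : NonZeroᴹ (node p₀ p₁) → NonZeroᴹ p₀
    p₀≠0 (node₀ p₀≠0) = p₀≠0
    p₀≠0 (node₁ p₁≠0) = ⊥-elim (IsZero⇒¬NonZero p₁≡0 p₁≠0)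

  -- Only the single fibre x₀ = c₀ can vanish identically; every other fibre is nonzero and has at
  -- most q₋₁ⁿ − q₋₂ⁿ zeros by induction.
  zeros-NonZero : ∀ (p : Multilinear n) → NonZeroᴹ p → zeros p ℕ.+ q₋₂ ^ n ≤ q₋₁ ^ n
  zeros-NonZero (leaf a) (leaf a≉0) with a ≟ 0#
  ... | yes a≈0 = ⊥-elim (a≉0 a≈0)
  ... | no _    = ℕP.≤-refl
  zeros-NonZero {suc n} p@(node _ _) p≠0 = ℕP.+-cancelʳ-≤ A _ _ (begin
    zeros p ℕ.+ q₋₂ ℕ.* A ℕ.+ A                               ≡⟨ reorder (zeros p) A q₋₂ ⟩
    zeros p ℕ.+ A ℕ.* suc q₋₂                                 ≡⟨ ≡.cong (λ k → zeros p ℕ.+ A ℕ.* k) q₋₁≡1+q₋₂ ⟨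
    zeros p ℕ.+ A ℕ.* q₋₁                                     ≡⟨ ≡.cong (zeros p ℕ.+_) (∑*-const A) ⟨
    zeros p ℕ.+ ∑* (λ _ → A)                                  ≡⟨ ∑*-+ {λ c → zeros (p [x₀≔ c ])} {λ _ → A} ⟨
    ∑* (λ c → zeros (p [x₀≔ c ]) ℕ.+ A)                       ≤⟨ ∑*-mono fibre ⟩
    ∑* (λ c → B ℕ.+ (if does (c ≟ c₀) then A else 0))         ≡⟨ ∑*-+ {λ _ → B} {λ c → if does (c ≟ c₀) then A else 0} ⟩
    ∑* (λ _ → B) ℕ.+ ∑* (λ c → if does (c ≟ c₀) then A else 0) ≤⟨ ℕP.+-mono-≤ (ℕP.≤-reflexive (∑*-const B)) (∑*-indicator-≤ c₀ A) ⟩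
    B ℕ.* q₋₁ ℕ.+ A                                           ≡⟨ ≡.cong (ℕ._+ A) (ℕP.*-comm B q₋₁) ⟩
    q₋₁ ℕ.* B ℕ.+ A                                           ∎)
    where
    open ℕP.≤-Reasoning
    A = q₋₂ ^ n
    B = q₋₁ ^ n
    c₀ = proj₁ (at-most-one-root p p≠0)
    fibre : ∀ c → ¬ c ≈ 0# → zeros (p [x₀≔ c ]) ℕ.+ A ≤ B ℕ.+ (if does (c ≟ c₀) then A else 0)
    fibre c _ with isZero? (p [x₀≔ c ])
    ... | inj₂ pc≠0 = ℕP.≤-trans (zeros-NonZero (p [x₀≔ c ]) pc≠0) (ℕP.m≤m+n B _)
    ... | inj₁ pc≡0 with c ≟ c₀
    ...   | yes _   = ℕP.+-monoˡ-≤ A (zeros-≤ (p [x₀≔ c ]))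
    ...   | no c≉c₀ = ⊥-elim (c≉c₀ (proj₂ (at-most-one-root p p≠0) c pc≡0))
    reorder : ∀ Z A R → Z ℕ.+ R ℕ.* A ℕ.+ A ≡ Z ℕ.+ A ℕ.* suc R
    reorder = solve-∀

  ∏[x-1] : ∀ n → Multilinear n
  ∏[x-1] zero    = leaf 1#
  ∏[x-1] (suc n) = node ((- 1#) ·ᴹ ∏[x-1] n) (∏[x-1] n)

  zeros-∏[x-1] : ∀ n → zeros (∏[x-1] n) ℕ.+ q₋₂ ^ n ≡ q₋₁ ^ n
  zeros-∏[x-1] zero with 1# ≟ 0#
  ... | yes 1≈0 = ⊥-elim (1≉0 1≈0)
  ... | no _    = ≡.refl
  zeros-∏[x-1] (suc n) = begin
    ∑* (λ c → zeros (∏[x-1] (suc n) [x₀≔ c ])) ℕ.+ q₋₂ ℕ.* R          ≡⟨ ≡.cong (ℕ._+ q₋₂ ℕ.* R) (∑*-cong fibre) ⟩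
    ∑* (λ c → if does (c ≟ 1#) then B else Z) ℕ.+ q₋₂ ℕ.* R          ≡⟨ ≡.cong (ℕ._+ q₋₂ ℕ.* R) (∑*-split-at-1 B Z) ⟩
    B ℕ.+ Z ℕ.* q₋₂ ℕ.+ q₋₂ ℕ.* R                                    ≡⟨ reorder B Z q₋₂ R ⟩
    B ℕ.+ q₋₂ ℕ.* (Z ℕ.+ R)                                          ≡⟨ ≡.cong (λ k → B ℕ.+ q₋₂ ℕ.* k) (zeros-∏[x-1] n) ⟩
    suc q₋₂ ℕ.* B                                                    ≡⟨ ≡.cong (ℕ._* B) q₋₁≡1+q₋₂ ⟨
    q₋₁ ℕ.* B                                                        ∎
    where
    open ≡.≡-Reasoning
    W = ∏[x-1] n
    Z = zeros W
    R = q₋₂ ^ n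
    B = q₋₁ ^ n
    fibre : ∀ c → ¬ c ≈ 0# → zeros (∏[x-1] (suc n) [x₀≔ c ]) ≡ (if does (c ≟ 1#) then B else Z)
    fibre c _ with c ≟ 1#
    ... | yes c≈1 = ≡.trans (zeros-cong (·ᴹ-distribʳ (- 1#) c W))
                            (zeros-IsZero (IsZero-·ᴹ W (trans (+-cong refl c≈1) (-‿inverseˡ 1#))))
    ... | no c≉1  = ≡.trans (zeros-cong (·ᴹ-distribʳ (- 1#) c W)) (zeros-·ᴹ W -1+c≉0)
      where
      -1+c≉0 : ¬ (- 1# + c) ≈ 0#
      -1+c≉0 -1+c≈0 = c≉1 (trans (inverseʳ-unique (- 1#) c -1+c≈0) (⁻¹-involutive 1#))
    reorder : ∀ B Z Q R → B ℕ.+ Z ℕ.* Q ℕ.+ Q ℕ.* R ≡ B ℕ.+ Q ℕ.* (Z ℕ.+ R)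
    reorder = solve-∀

  -- a scalar multiple of the top monomial x₀x₁⋯xₙ₋₁
  data IsTopMultiple : Multilinear n → Set where
    leaf : ∀ {a} → IsTopMultiple (leaf a)
    node : IsZeroᴹ p₀ → IsTopMultiple p₁ → IsTopMultiple (node p₀ p₁)

  data HasLowerTerm : Multilinear n → Set where
    node₀ : NonZeroᴹ p₀ → HasLowerTerm (node p₀ p₁)
    node₁ : HasLowerTerm p₁ → HasLowerTerm (node p₀ p₁)

  top : Multilinear n → Carrier
  top (leaf a)     = a
  top (node _ p₁) = top p₁

  top-∏[x-1] : ∀ n → top (∏[x-1] n) ≡ 1#
  top-∏[x-1] zero    = ≡.refl
  top-∏[x-1] (suc n) = top-∏[x-1] n

  isTopMultiple? : ∀ (p : Multilinear n) → IsTopMultiple p ⊎ HasLowerTerm p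
  isTopMultiple? (leaf a) = inj₁ leaf
  isTopMultiple? (node p₀ p₁) with isZero? p₀ | isTopMultiple? p₁
  ... | inj₂ p₀≠0 | _        = inj₂ (node₀ p₀≠0)
  ... | inj₁ _    | inj₂ low = inj₂ (node₁ low)
  ... | inj₁ p₀≡0 | inj₁ top₁ = inj₁ (node p₀≡0 top₁)

  HasLowerTerm⇒NonZero : HasLowerTerm p → NonZeroᴹ p
  HasLowerTerm⇒NonZero (node₀ p₀≠0) = node₀ p₀≠0
  HasLowerTerm⇒NonZero (node₁ low)  = node₁ (HasLowerTerm⇒NonZero low)

  IsZero⇒IsTopMultiple : IsZeroᴹ p → IsTopMultiple p
  IsZero⇒IsTopMultiple (leaf _)          = leaf
  IsZero⇒IsTopMultiple (node p₀≡0 p₁≡0) = node p₀≡0 (IsZero⇒IsTopMultiple p₁≡0)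

  IsTopMultiple-+ᴹ·ᴹ : ∀ c → IsTopMultiple p → IsTopMultiple r → IsTopMultiple (p +ᴹ c ·ᴹ r)
  IsTopMultiple-+ᴹ·ᴹ c leaf              leaf              = leaf
  IsTopMultiple-+ᴹ·ᴹ c (node p₀≡0 top₁) (node r₀≡0 top₁′) =
    node (IsZero-+ᴹ·ᴹ c p₀≡0 r₀≡0) (IsTopMultiple-+ᴹ·ᴹ c top₁ top₁′)

  HasLowerTerm-+ᴹ·ᴹ : ∀ c → HasLowerTerm p → IsTopMultiple r → HasLowerTerm (p +ᴹ c ·ᴹ r)
  HasLowerTerm-+ᴹ·ᴹ c (node₀ {p₀ = p₀} p₀≠0) (node r₀≡0 _) =
    node₀ (NonZero-resp-≈ᴹ (≈ᴹ-sym (+ᴹ·ᴹ-IsZero c p₀ r₀≡0)) p₀≠0)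
  HasLowerTerm-+ᴹ·ᴹ c (node₁ low)             (node _ top₁) = node₁ (HasLowerTerm-+ᴹ·ᴹ c low top₁)

  top-+ᴹ·ᴹ : ∀ c (p r : Multilinear n) → top (p +ᴹ c ·ᴹ r) ≡ top p + c * top r
  top-+ᴹ·ᴹ c (leaf a)    (leaf b)    = ≡.refl
  top-+ᴹ·ᴹ c (node _ p₁) (node _ r₁) = top-+ᴹ·ᴹ c p₁ r₁

  top-IsZero : IsZeroᴹ p → top p ≈ 0#
  top-IsZero (leaf a≈0)    = a≈0
  top-IsZero (node _ p₁≡0) = top-IsZero p₁≡0

  top-NonZero : IsTopMultiple p → NonZeroᴹ p → ¬ top p ≈ 0#
  top-NonZero leaf             (leaf a≉0)   = a≉0
  top-NonZero (node p₀≡0 _)    (node₀ p₀≠0) = ⊥-elim (IsZero⇒¬NonZero p₀≡0 p₀≠0)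
  top-NonZero (node _ top₁)    (node₁ p₁≠0) = top-NonZero top₁ p₁≠0

  zeros-IsTopMultiple : IsTopMultiple p → zeros {n} p ≡ (if does (top p ≟ 0#) then 1 else 0) ℕ.* q₋₁ ^ n
  zeros-IsTopMultiple {n = zero} leaf = ≡.sym (ℕP.*-identityʳ _)
  zeros-IsTopMultiple {n = suc n} {p = p@(node p₀ p₁)} (node p₀≡0 top₁) = begin
    ∑* (λ c → zeros (p [x₀≔ c ]))                      ≡⟨ ∑*-cong fibre ⟩
    ∑* (λ _ → [top≈0] p₁ ℕ.* q₋₁ ^ n)                ≡⟨ ∑*-const _ ⟩
    [top≈0] p₁ ℕ.* q₋₁ ^ n ℕ.* q₋₁                   ≡⟨ reorder ([top≈0] p₁) (q₋₁ ^ n) q₋₁ ⟩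
    [top≈0] p₁ ℕ.* q₋₁ ^ suc n                       ∎
    where
    open ≡.≡-Reasoning
    [top≈0] : Multilinear n → ℕ
    [top≈0] r = if does (top r ≟ 0#) then 1 else 0
    top-fibre : ∀ c → top (p [x₀≔ c ]) ≈ c * top p₁
    top-fibre c = trans (reflexive (top-+ᴹ·ᴹ c p₀ p₁)) (trans (+-cong (top-IsZero p₀≡0) refl) (+-identityˡ _))
    fibre : ∀ c → ¬ c ≈ 0# → zeros (p [x₀≔ c ]) ≡ [top≈0] p₁ ℕ.* q₋₁ ^ n
    fibre c c≉0 = ≡.trans (zeros-IsTopMultiple (IsTopMultiple-+ᴹ·ᴹ c (IsZero⇒IsTopMultiple p₀≡0) top₁))
      (≡.cong (ℕ._* q₋₁ ^ n) (if-does-⇔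
        (mk⇔ (λ t≈0 → nonzero*x≈0⇒x≈0 c _ c≉0 (trans (sym (top-fibre c)) t≈0))
             (λ t₁≈0 → trans (top-fibre c) (trans (*-cong refl t₁≈0) (zeroʳ c))))
        (top (p [x₀≔ c ]) ≟ 0#) (top p₁ ≟ 0#)))
    reorder : ∀ I B Q → I ℕ.* B ℕ.* Q ≡ I ℕ.* (Q ℕ.* B)
    reorder = solve-∀

  monomial : (Fin n → Bool) → Multilinear n
  monomial {zero}  S = leaf 1#
  monomial {suc n} S = if S Fin.zero then node 0ᴹ (monomial (S ∘ Fin.suc)) else node (monomial (S ∘ Fin.suc)) 0ᴹ

  monomial-≗ : ∀ {S T : Fin n → Bool} → S ≗ T → monomial S ≡ monomial T
  monomial-≗ {zero}          S≗T = ≡.refl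
  monomial-≗ {suc n} {S} {T} S≗T rewrite S≗T Fin.zero | monomial-≗ (S≗T ∘ Fin.suc) = ≡.refl

  IsTopMultiple-monomial : ∀ (S : Fin n → Bool) → (∀ i → S i ≡ true) → IsTopMultiple (monomial S)
  IsTopMultiple-monomial {zero}  S all-true = leaf
  IsTopMultiple-monomial {suc n} S all-true with S Fin.zero in S₀
  ... | true  = node IsZero-0ᴹ (IsTopMultiple-monomial (S ∘ Fin.suc) (all-true ∘ Fin.suc))
  ... | false with () ← ≡.trans (≡.sym S₀) (all-true Fin.zero)

  ⟦monomial⟧ : ∀ (S : Fin n → Bool) τ → ⟦ monomial S ⟧ τ ≈ foldr _*_ 1# (tabulate (λ i → if S i then τ i else 1#))
  ⟦monomial⟧ {zero}  S τ = refl
  ⟦monomial⟧ {suc n} S τ with S Fin.zero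
  ... | true  = begin
    ⟦ 0ᴹ {n} ⟧ τ′ + τ Fin.zero * ⟦ monomial (S ∘ Fin.suc) ⟧ τ′ ≈⟨ +-cong (⟦0ᴹ⟧ τ′) (*-cong refl (⟦monomial⟧ (S ∘ Fin.suc) τ′)) ⟩
    0# + τ Fin.zero * rest                                     ≈⟨ +-identityˡ _ ⟩
    τ Fin.zero * rest                                          ∎
    where
    open ≈-Reasoning
    τ′ = τ ∘ Fin.suc
    rest = foldr _*_ 1# (tabulate (λ i → if S (Fin.suc i) then τ′ i else 1#))
  ... | false = begin
    ⟦ monomial (S ∘ Fin.suc) ⟧ τ′ + τ Fin.zero * ⟦ 0ᴹ {n} ⟧ τ′ ≈⟨ +-cong (⟦monomial⟧ (S ∘ Fin.suc) τ′) (*-cong refl (⟦0ᴹ⟧ τ′)) ⟩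
    rest + τ Fin.zero * 0#                                     ≈⟨ trans (+-cong refl (zeroʳ _)) (+-identityʳ _) ⟩
    rest                                                       ≈⟨ *-identityˡ rest ⟨
    1# * rest                                                  ∎
    where
    open ≈-Reasoning
    τ′ = τ ∘ Fin.suc
    rest = foldr _*_ 1# (tabulate (λ i → if S (Fin.suc i) then τ′ i else 1#))

  coefficient : Multilinear n → (Fin n → Bool) → Carrier
  coefficient (leaf a)     S = a
  coefficient (node p₀ p₁) S = (if S Fin.zero then coefficient p₁ else coefficient p₀) (S ∘ Fin.suc)

  coefficient-top : ∀ (p : Multilinear n) → coefficient p (λ _ → true) ≡ top p
  coefficient-top (leaf a)     = ≡.refl
  coefficient-top (node _ p₁) = coefficient-top p₁

  coefficient-cong : ∀ S → p ≈ᴹ r → coefficient p S ≈ coefficient r S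
  coefficient-cong S (leaf e) = e
  coefficient-cong S (node e₀ e₁) with S Fin.zero
  ... | true  = coefficient-cong (S ∘ Fin.suc) e₁
  ... | false = coefficient-cong (S ∘ Fin.suc) e₀

  coefficient-0ᴹ : ∀ S → coefficient (0ᴹ {n}) S ≈ 0#
  coefficient-0ᴹ {zero}  S = refl
  coefficient-0ᴹ {suc n} S with S Fin.zero
  ... | true  = coefficient-0ᴹ {n} (S ∘ Fin.suc)
  ... | false = coefficient-0ᴹ {n} (S ∘ Fin.suc)

  coefficient-+ᴹ·ᴹ : ∀ c (p r : Multilinear n) S → coefficient (p +ᴹ c ·ᴹ r) S ≈ coefficient p S + c * coefficient r S
  coefficient-+ᴹ·ᴹ c (leaf a)     (leaf b)     S = refl
  coefficient-+ᴹ·ᴹ c (node p₀ p₁) (node r₀ r₁) S with S Fin.zero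
  ... | true  = coefficient-+ᴹ·ᴹ c p₁ r₁ (S ∘ Fin.suc)
  ... | false = coefficient-+ᴹ·ᴹ c p₀ r₀ (S ∘ Fin.suc)

  coefficient-node : ∀ {b} (p₀ p₁ : Multilinear n) S → S Fin.zero ≡ b →
                     coefficient (node p₀ p₁) S ≡ (if b then coefficient p₁ else coefficient p₀) (S ∘ Fin.suc)
  coefficient-node p₀ p₁ S ≡.refl = ≡.refl

  coefficient-monomial-≗ : ∀ {S T : Fin n → Bool} → S ≗ T → coefficient (monomial S) T ≈ 1#
  coefficient-monomial-≗ {zero}          S≗T = refl
  coefficient-monomial-≗ {suc n} {S} {T} S≗T with S Fin.zero in S₀
  ... | true  = trans (reflexive (coefficient-node 0ᴹ (monomial (S ∘ Fin.suc)) T (≡.trans (≡.sym (S≗T Fin.zero)) S₀)))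
                      (coefficient-monomial-≗ (S≗T ∘ Fin.suc))
  ... | false = trans (reflexive (coefficient-node (monomial (S ∘ Fin.suc)) 0ᴹ T (≡.trans (≡.sym (S≗T Fin.zero)) S₀)))
                      (coefficient-monomial-≗ (S≗T ∘ Fin.suc))

  coefficient-monomial-≭ : ∀ {S T : Fin n → Bool} → ¬ S ≗ T → coefficient (monomial S) T ≈ 0#
  coefficient-monomial-≭ {zero}          S≭T = ⊥-elim (S≭T (λ ()))
  coefficient-monomial-≭ {suc n} {S} {T} S≭T with S Fin.zero in S₀ | T Fin.zero in T₀
  ... | true  | false = trans (reflexive (coefficient-node 0ᴹ (monomial (S ∘ Fin.suc)) T T₀)) (coefficient-0ᴹ (T ∘ Fin.suc))
  ... | false | true  = trans (reflexive (coefficient-node (monomial (S ∘ Fin.suc)) 0ᴹ T T₀)) (coefficient-0ᴹ (T ∘ Fin.suc))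
  ... | true  | true  = trans (reflexive (coefficient-node 0ᴹ (monomial (S ∘ Fin.suc)) T T₀)) (coefficient-monomial-≭ tails-differ)
    where
    tails-differ : ¬ (S ∘ Fin.suc) ≗ (T ∘ Fin.suc)
    tails-differ S′≗T′ = S≭T (λ { Fin.zero → ≡.trans S₀ (≡.sym T₀) ; (Fin.suc i) → S′≗T′ i })
  ... | false | false = trans (reflexive (coefficient-node (monomial (S ∘ Fin.suc)) 0ᴹ T T₀)) (coefficient-monomial-≭ tails-differ)
    where
    tails-differ : ¬ (S ∘ Fin.suc) ≗ (T ∘ Fin.suc)
    tails-differ S′≗T′ = S≭T (λ { Fin.zero → ≡.trans S₀ (≡.sym T₀) ; (Fin.suc i) → S′≗T′ i })

  coefficient-NonZero : ∀ (p : Multilinear n) S → ¬ coefficient p S ≈ 0# → NonZeroᴹ p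
  coefficient-NonZero (leaf a)     S a≉0 = leaf a≉0
  coefficient-NonZero (node p₀ p₁) S c≉0 with S Fin.zero
  ... | true  = node₁ (coefficient-NonZero p₁ (S ∘ Fin.suc) c≉0)
  ... | false = node₀ (coefficient-NonZero p₀ (S ∘ Fin.suc) c≉0)

  Term : ℕ → Set
  Term n = Carrier × (Fin n → Bool)

  sumTerms : List (Term n) → Multilinear n
  sumTerms []            = 0ᴹ
  sumTerms ((c , S) ∷ ts) = sumTerms ts +ᴹ c ·ᴹ monomial S

  extendTerm : Bool → Term n → Term (suc n)
  extendTerm b (c , S) = c , b Vector.∷ S

  terms : Multilinear n → List (Term n)
  terms (leaf a)     = (a , λ ()) ∷ []
  terms (node p₀ p₁) = map (extendTerm false) (terms p₀) ++ map (extendTerm true) (terms p₁)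

  sumTerms-++ : ∀ (ts us : List (Term n)) → sumTerms (ts ++ us) ≈ᴹ sumTerms ts +ᴹ sumTerms us
  sumTerms-++ []             us = ≈ᴹ-sym (+ᴹ-identityˡ _)
  sumTerms-++ ((c , S) ∷ ts) us = begin
    sumTerms (ts ++ us) +ᴹ c ·ᴹ monomial S         ≈⟨ +ᴹ-cong (sumTerms-++ ts us) ≈ᴹ-refl ⟩
    (sumTerms ts +ᴹ sumTerms us) +ᴹ c ·ᴹ monomial S ≈⟨ +ᴹ-assoc _ _ _ ⟩
    sumTerms ts +ᴹ (sumTerms us +ᴹ c ·ᴹ monomial S) ≈⟨ +ᴹ-cong ≈ᴹ-refl (+ᴹ-comm _ _) ⟩
    sumTerms ts +ᴹ (c ·ᴹ monomial S +ᴹ sumTerms us) ≈⟨ +ᴹ-assoc _ _ _ ⟨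
    (sumTerms ts +ᴹ c ·ᴹ monomial S) +ᴹ sumTerms us ∎
    where open import Relation.Binary.Reasoning.Setoid (≈ᴹ-setoid _)

  sumTerms-extend-false : ∀ (ts : List (Term n)) → sumTerms (map (extendTerm false) ts) ≈ᴹ node (sumTerms ts) 0ᴹ
  sumTerms-extend-false []             = ≈ᴹ-refl
  sumTerms-extend-false ((c , S) ∷ ts) =
    ≈ᴹ-trans (+ᴹ-cong (sumTerms-extend-false ts) ≈ᴹ-refl) (node ≈ᴹ-refl (+ᴹ·ᴹ-IsZero c 0ᴹ IsZero-0ᴹ))

  sumTerms-extend-true : ∀ (ts : List (Term n)) → sumTerms (map (extendTerm true) ts) ≈ᴹ node 0ᴹ (sumTerms ts)
  sumTerms-extend-true []             = ≈ᴹ-refl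
  sumTerms-extend-true ((c , S) ∷ ts) =
    ≈ᴹ-trans (+ᴹ-cong (sumTerms-extend-true ts) ≈ᴹ-refl) (node (+ᴹ·ᴹ-IsZero c 0ᴹ IsZero-0ᴹ) ≈ᴹ-refl)

  sumTerms-terms : ∀ (p : Multilinear n) → sumTerms (terms p) ≈ᴹ p
  sumTerms-terms (leaf a)     = leaf (trans (+-identityˡ _) (*-identityʳ a))
  sumTerms-terms (node p₀ p₁) = begin
    sumTerms (map (extendTerm false) (terms p₀) ++ map (extendTerm true) (terms p₁))
      ≈⟨ sumTerms-++ (map (extendTerm false) (terms p₀)) (map (extendTerm true) (terms p₁)) ⟩
    sumTerms (map (extendTerm false) (terms p₀)) +ᴹ sumTerms (map (extendTerm true) (terms p₁))
      ≈⟨ +ᴹ-cong (sumTerms-extend-false (terms p₀)) (sumTerms-extend-true (terms p₁)) ⟩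
    node (sumTerms (terms p₀) +ᴹ 0ᴹ) (0ᴹ +ᴹ sumTerms (terms p₁))
      ≈⟨ node (≈ᴹ-trans (+ᴹ-identityʳ _) (sumTerms-terms p₀)) (≈ᴹ-trans (+ᴹ-identityˡ _) (sumTerms-terms p₁)) ⟩
    node p₀ p₁ ∎
    where open import Relation.Binary.Reasoning.Setoid (≈ᴹ-setoid _)

  -- A polynomial in a + b variables, read as a polynomial in the first a (outer) variables
  -- whose coefficients are polynomials in the last b (inner) ones.
  module Blocks (b : ℕ) where

    constantPart : ∀ a → Multilinear (a ℕ.+ b) → Multilinear b
    constantPart zero    C           = C
    constantPart (suc a) (node C₀ _) = constantPart a C₀

    AllTopMultiple : ∀ a → Multilinear (a ℕ.+ b) → Set
    AllTopMultiple zero    C            = IsTopMultiple C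
    AllTopMultiple (suc a) (node C₀ C₁) = AllTopMultiple a C₀ × AllTopMultiple a C₁

    -- Every coefficient other than the constant one is a multiple of the inner top monomial:
    -- the shape g(y) + y₁⋯y_b·h(x) of the polynomials supported on O_{Aₐ ⊕ A_b}.
    OrdinalShape : ∀ a → Multilinear (a ℕ.+ b) → Set
    OrdinalShape zero    C            = ⊤
    OrdinalShape (suc a) (node C₀ C₁) = OrdinalShape a C₀ × AllTopMultiple a C₁

    topCoefficients : ∀ a → Multilinear (a ℕ.+ b) → Multilinear a
    topCoefficients zero    C            = leaf (top C)
    topCoefficients (suc a) (node C₀ C₁) = node (topCoefficients a C₀) (topCoefficients a C₁)

    inner : ∀ a → Multilinear b → Multilinear (a ℕ.+ b)
    inner zero    w = w
    inner (suc a) w = node (inner a w) 0ᴹ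

    constantPart-+ᴹ·ᴹ : ∀ a c (C D : Multilinear (a ℕ.+ b)) →
                        constantPart a (C +ᴹ c ·ᴹ D) ≡ constantPart a C +ᴹ c ·ᴹ constantPart a D
    constantPart-+ᴹ·ᴹ zero    c C            D            = ≡.refl
    constantPart-+ᴹ·ᴹ (suc a) c (node C₀ _) (node D₀ _) = constantPart-+ᴹ·ᴹ a c C₀ D₀

    topCoefficients-+ᴹ·ᴹ : ∀ a c (C D : Multilinear (a ℕ.+ b)) →
                           topCoefficients a (C +ᴹ c ·ᴹ D) ≡ topCoefficients a C +ᴹ c ·ᴹ topCoefficients a D
    topCoefficients-+ᴹ·ᴹ zero    c C            D            = ≡.cong leaf (top-+ᴹ·ᴹ c C D)
    topCoefficients-+ᴹ·ᴹ (suc a) c (node C₀ C₁) (node D₀ D₁) =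
      ≡.cong₂ node (topCoefficients-+ᴹ·ᴹ a c C₀ D₀) (topCoefficients-+ᴹ·ᴹ a c C₁ D₁)

    AllTopMultiple-+ᴹ·ᴹ : ∀ a c {C D : Multilinear (a ℕ.+ b)} →
                          AllTopMultiple a C → AllTopMultiple a D → AllTopMultiple a (C +ᴹ c ·ᴹ D)
    AllTopMultiple-+ᴹ·ᴹ zero    c top-C top-D = IsTopMultiple-+ᴹ·ᴹ c top-C top-D
    AllTopMultiple-+ᴹ·ᴹ (suc a) c {node _ _} {node _ _} (top-C₀ , top-C₁) (top-D₀ , top-D₁) =
      AllTopMultiple-+ᴹ·ᴹ a c top-C₀ top-D₀ , AllTopMultiple-+ᴹ·ᴹ a c top-C₁ top-D₁

    OrdinalShape-+ᴹ·ᴹ : ∀ a c {C D : Multilinear (a ℕ.+ b)} →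
                        OrdinalShape a C → OrdinalShape a D → OrdinalShape a (C +ᴹ c ·ᴹ D)
    OrdinalShape-+ᴹ·ᴹ zero    c _ _ = tt
    OrdinalShape-+ᴹ·ᴹ (suc a) c {node _ _} {node _ _} (shape-C₀ , top-C₁) (shape-D₀ , top-D₁) =
      OrdinalShape-+ᴹ·ᴹ a c shape-C₀ shape-D₀ , AllTopMultiple-+ᴹ·ᴹ a c top-C₁ top-D₁

    AllTopMultiple-0ᴹ : ∀ a → AllTopMultiple a 0ᴹ
    AllTopMultiple-0ᴹ zero    = IsZero⇒IsTopMultiple IsZero-0ᴹ
    AllTopMultiple-0ᴹ (suc a) = AllTopMultiple-0ᴹ a , AllTopMultiple-0ᴹ a

    AllTopMultiple⇒OrdinalShape : ∀ a {C : Multilinear (a ℕ.+ b)} → AllTopMultiple a C → OrdinalShape a C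
    AllTopMultiple⇒OrdinalShape zero    _                           = tt
    AllTopMultiple⇒OrdinalShape (suc a) {node _ _} (top-C₀ , top-C₁) = AllTopMultiple⇒OrdinalShape a top-C₀ , top-C₁

    AllTopMultiple⇒constantPart : ∀ a {C : Multilinear (a ℕ.+ b)} → AllTopMultiple a C → IsTopMultiple (constantPart a C)
    AllTopMultiple⇒constantPart zero    top-C               = top-C
    AllTopMultiple⇒constantPart (suc a) {node _ _} (top-C₀ , _) = AllTopMultiple⇒constantPart a top-C₀

    OrdinalShape⇒AllTopMultiple : ∀ a {C : Multilinear (a ℕ.+ b)} →
                                  OrdinalShape a C → IsTopMultiple (constantPart a C) → AllTopMultiple a C
    OrdinalShape⇒AllTopMultiple zero    _                     top-C₀ = top-C₀
    OrdinalShape⇒AllTopMultiple (suc a) {node _ _} (shape , top-C₁) top-C₀ = OrdinalShape⇒AllTopMultiple a shape top-C₀ , top-C₁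

    -- Substituting an outer variable keeps the lower term of the constant part, since the other
    -- coefficients are top multiples; so C(x, ·) is nonzero for every outer point x.
    zeros-HasLowerTerm : ∀ a (C : Multilinear (a ℕ.+ b)) → OrdinalShape a C → HasLowerTerm (constantPart a C) →
                         zeros C ℕ.+ q₋₁ ^ a ℕ.* q₋₂ ^ b ≤ q₋₁ ^ a ℕ.* q₋₁ ^ b
    zeros-HasLowerTerm zero    C _ low = ≡.subst₂ _≤_ (≡.cong (zeros C ℕ.+_) (≡.sym (ℕP.+-identityʳ _)))
                                                    (≡.sym (ℕP.+-identityʳ _))
                                                    (zeros-NonZero C (HasLowerTerm⇒NonZero low))
    zeros-HasLowerTerm (suc a) C@(node C₀ C₁) (shape-C₀ , top-C₁) low = begin
      zeros C ℕ.+ q₋₁ ℕ.* q₋₁ ^ a ℕ.* q₋₂ ^ b       ≡⟨ ≡.cong (zeros C ℕ.+_) (reorder q₋₁ (q₋₁ ^ a) (q₋₂ ^ b)) ⟩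
      zeros C ℕ.+ K ℕ.* q₋₁                         ≡⟨ ≡.cong (zeros C ℕ.+_) (∑*-const K) ⟨
      zeros C ℕ.+ ∑* (λ _ → K)                      ≡⟨ ∑*-+ {λ c → zeros (C [x₀≔ c ])} {λ _ → K} ⟨
      ∑* (λ c → zeros (C [x₀≔ c ]) ℕ.+ K)           ≤⟨ ∑*-mono (λ c _ → fibre c) ⟩
      ∑* (λ _ → q₋₁ ^ a ℕ.* q₋₁ ^ b)                ≡⟨ ∑*-const _ ⟩
      q₋₁ ^ a ℕ.* q₋₁ ^ b ℕ.* q₋₁                   ≡⟨ reorder q₋₁ (q₋₁ ^ a) (q₋₁ ^ b) ⟨
      q₋₁ ℕ.* q₋₁ ^ a ℕ.* q₋₁ ^ b                   ∎
      where
      open ℕP.≤-Reasoning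
      K = q₋₁ ^ a ℕ.* q₋₂ ^ b
      fibre : ∀ c → zeros (C [x₀≔ c ]) ℕ.+ K ≤ q₋₁ ^ a ℕ.* q₋₁ ^ b
      fibre c = zeros-HasLowerTerm a (C [x₀≔ c ])
        (OrdinalShape-+ᴹ·ᴹ a c shape-C₀ (AllTopMultiple⇒OrdinalShape a top-C₁))
        (≡.subst HasLowerTerm (≡.sym (constantPart-+ᴹ·ᴹ a c C₀ C₁))
                 (HasLowerTerm-+ᴹ·ᴹ c low (AllTopMultiple⇒constantPart a top-C₁)))
      reorder : ∀ Q X Y → Q ℕ.* X ℕ.* Y ≡ X ℕ.* Y ℕ.* Q
      reorder = solve-∀

    zeros-AllTopMultiple : ∀ a {C : Multilinear (a ℕ.+ b)} → AllTopMultiple a C →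
                           zeros C ≡ zeros (topCoefficients a C) ℕ.* q₋₁ ^ b
    zeros-AllTopMultiple zero    top-C = zeros-IsTopMultiple top-C
    zeros-AllTopMultiple (suc a) {C@(node C₀ C₁)} (top-C₀ , top-C₁) = begin
      ∑* (λ c → zeros (C [x₀≔ c ]))                                  ≡⟨ ∑*-cong (λ c _ → fibre c) ⟩
      ∑* (λ c → q₋₁ ^ b ℕ.* zeros (topCoefficients (suc a) C [x₀≔ c ]))
        ≡⟨ ∑*-*ˡ (q₋₁ ^ b) (λ c → zeros (topCoefficients (suc a) C [x₀≔ c ])) ⟩
      q₋₁ ^ b ℕ.* zeros (topCoefficients (suc a) C)                  ≡⟨ ℕP.*-comm (q₋₁ ^ b) _ ⟩
      zeros (topCoefficients (suc a) C) ℕ.* q₋₁ ^ b                  ∎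
      where
      open ≡.≡-Reasoning
      fibre : ∀ c → zeros (C [x₀≔ c ]) ≡ q₋₁ ^ b ℕ.* zeros (topCoefficients (suc a) C [x₀≔ c ])
      fibre c = ≡.trans (zeros-AllTopMultiple a (AllTopMultiple-+ᴹ·ᴹ a c top-C₀ top-C₁))
                (≡.trans (≡.cong (λ t → zeros t ℕ.* q₋₁ ^ b) (topCoefficients-+ᴹ·ᴹ a c C₀ C₁))
                         (ℕP.*-comm _ (q₋₁ ^ b)))

    NonZero-topCoefficients : ∀ a {C : Multilinear (a ℕ.+ b)} → AllTopMultiple a C → NonZeroᴹ C →
                              NonZeroᴹ (topCoefficients a C)
    NonZero-topCoefficients zero    top-C              C≠0           = leaf (top-NonZero top-C C≠0)
    NonZero-topCoefficients (suc a) {node _ _} (top-C₀ , _) (node₀ C₀≠0) = node₀ (NonZero-topCoefficients a top-C₀ C₀≠0)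
    NonZero-topCoefficients (suc a) {node _ _} (_ , top-C₁) (node₁ C₁≠0) = node₁ (NonZero-topCoefficients a top-C₁ C₁≠0)

    zeros-AllTopMultiple-NonZero : ∀ a (C : Multilinear (a ℕ.+ b)) → AllTopMultiple a C → NonZeroᴹ C →
                                   zeros C ℕ.+ q₋₂ ^ a ℕ.* q₋₁ ^ b ≤ q₋₁ ^ a ℕ.* q₋₁ ^ b
    zeros-AllTopMultiple-NonZero a C top-C C≠0 = begin
      zeros C ℕ.+ q₋₂ ^ a ℕ.* q₋₁ ^ b                              ≡⟨ ≡.cong (ℕ._+ q₋₂ ^ a ℕ.* q₋₁ ^ b) (zeros-AllTopMultiple a top-C) ⟩
      zeros (topCoefficients a C) ℕ.* q₋₁ ^ b ℕ.+ q₋₂ ^ a ℕ.* q₋₁ ^ b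
        ≡⟨ ℕP.*-distribʳ-+ (q₋₁ ^ b) (zeros (topCoefficients a C)) (q₋₂ ^ a) ⟨
      (zeros (topCoefficients a C) ℕ.+ q₋₂ ^ a) ℕ.* q₋₁ ^ b
        ≤⟨ ℕP.*-monoˡ-≤ (q₋₁ ^ b) (zeros-NonZero _ (NonZero-topCoefficients a top-C C≠0)) ⟩
      q₋₁ ^ a ℕ.* q₋₁ ^ b                                            ∎
      where open ℕP.≤-Reasoning

    zeros-OrdinalShape : ∀ a (C : Multilinear (a ℕ.+ b)) → OrdinalShape a C → NonZeroᴹ C →
                         zeros C ℕ.+ q₋₂ ^ a ℕ.* q₋₁ ^ b ≤ q₋₁ ^ a ℕ.* q₋₁ ^ b
                         ⊎ zeros C ℕ.+ q₋₁ ^ a ℕ.* q₋₂ ^ b ≤ q₋₁ ^ a ℕ.* q₋₁ ^ b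
    zeros-OrdinalShape a C shape C≠0 with isTopMultiple? (constantPart a C)
    ... | inj₁ top-C₀ = inj₁ (zeros-AllTopMultiple-NonZero a C (OrdinalShape⇒AllTopMultiple a shape top-C₀) C≠0)
    ... | inj₂ low    = inj₂ (zeros-HasLowerTerm a C shape low)

    inner-cong : ∀ a {v w : Multilinear b} → v ≈ᴹ w → inner a v ≈ᴹ inner a w
    inner-cong zero    v≈w = v≈w
    inner-cong (suc a) v≈w = node (inner-cong a v≈w) ≈ᴹ-refl

    inner-0ᴹ : ∀ a → inner a (0ᴹ {b}) ≈ᴹ 0ᴹ
    inner-0ᴹ zero    = ≈ᴹ-refl
    inner-0ᴹ (suc a) = node (inner-0ᴹ a) ≈ᴹ-refl

    inner-+ᴹ·ᴹ : ∀ a c (v w : Multilinear b) → inner a (v +ᴹ c ·ᴹ w) ≈ᴹ inner a v +ᴹ c ·ᴹ inner a w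
    inner-+ᴹ·ᴹ zero    c v w = ≈ᴹ-refl
    inner-+ᴹ·ᴹ (suc a) c v w = node (inner-+ᴹ·ᴹ a c v w) (≈ᴹ-sym (+ᴹ·ᴹ-IsZero c 0ᴹ IsZero-0ᴹ))

    OrdinalShape-0ᴹ : ∀ a → OrdinalShape a 0ᴹ
    OrdinalShape-0ᴹ a = AllTopMultiple⇒OrdinalShape a (AllTopMultiple-0ᴹ a)

    AllTopMultiple-monomial : ∀ a (S : Fin (a ℕ.+ b) → Bool) → (∀ j → S (a Fin.↑ʳ j) ≡ true) →
                              AllTopMultiple a (monomial S)
    AllTopMultiple-monomial zero    S inner-true = IsTopMultiple-monomial S inner-true
    AllTopMultiple-monomial (suc a) S inner-true with S Fin.zero
    ... | true  = AllTopMultiple-0ᴹ a , AllTopMultiple-monomial a (S ∘ Fin.suc) inner-true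
    ... | false = AllTopMultiple-monomial a (S ∘ Fin.suc) inner-true , AllTopMultiple-0ᴹ a

    OrdinalShape-monomial : ∀ a (S : Fin (a ℕ.+ b) → Bool) →
                            (∀ i → S (i Fin.↑ˡ b) ≡ true → ∀ j → S (a Fin.↑ʳ j) ≡ true) →
                            OrdinalShape a (monomial S)
    OrdinalShape-monomial zero    S upward = tt
    OrdinalShape-monomial (suc a) S upward with S Fin.zero in S₀
    ... | true  = OrdinalShape-0ᴹ a , AllTopMultiple-monomial a (S ∘ Fin.suc) (upward Fin.zero S₀)
    ... | false = OrdinalShape-monomial a (S ∘ Fin.suc) (upward ∘ Fin.suc) , AllTopMultiple-0ᴹ a

    padFalse : ∀ a → (Fin b → Bool) → Fin (a ℕ.+ b) → Bool
    padFalse zero    S = S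
    padFalse (suc a) S = false Vector.∷ padFalse a S

    padFalse-splitAt : ∀ a S i → padFalse a S i ≡ [ (λ _ → false) , S ] (splitAt a i)
    padFalse-splitAt zero    S i           = ≡.refl
    padFalse-splitAt (suc a) S Fin.zero    = ≡.refl
    padFalse-splitAt (suc a) S (Fin.suc i) with splitAt a i | padFalse-splitAt a S i
    ... | inj₁ _ | eq = eq
    ... | inj₂ _ | eq = eq

    monomial-padFalse : ∀ a S → monomial (padFalse a S) ≡ inner a (monomial S)
    monomial-padFalse zero    S = ≡.refl
    monomial-padFalse (suc a) S = ≡.cong (λ t → node t 0ᴹ) (monomial-padFalse a S)

    coefficient-inner : ∀ a (w : Multilinear b) S → coefficient (inner a w) (padFalse a S) ≡ coefficient w S
    coefficient-inner zero    w S = ≡.refl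
    coefficient-inner (suc a) w S = coefficient-inner a w S

    zeros-inner : ∀ a (w : Multilinear b) → zeros (inner a w) ≡ q₋₁ ^ a ℕ.* zeros w
    zeros-inner zero    w = ≡.sym (ℕP.+-identityʳ _)
    zeros-inner (suc a) w = begin
      ∑* (λ c → zeros (inner a w +ᴹ c ·ᴹ 0ᴹ)) ≡⟨ ∑*-cong (λ c _ → zeros-cong (+ᴹ·ᴹ-IsZero c (inner a w) IsZero-0ᴹ)) ⟩
      ∑* (λ _ → zeros (inner a w))            ≡⟨ ∑*-const _ ⟩
      zeros (inner a w) ℕ.* q₋₁               ≡⟨ ≡.cong (ℕ._* q₋₁) (zeros-inner a w) ⟩
      q₋₁ ^ a ℕ.* zeros w ℕ.* q₋₁             ≡⟨ reorder (q₋₁ ^ a) (zeros w) q₋₁ ⟩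
      q₋₁ ℕ.* q₋₁ ^ a ℕ.* zeros w             ∎
      where
      open ≡.≡-Reasoning
      reorder : ∀ X Z Q → X ℕ.* Z ℕ.* Q ≡ Q ℕ.* X ℕ.* Z
      reorder = solve-∀

-- Zeros on the torus, counted by enumeration

length-filter-++ : ∀ {A : Set} {P : A → Set} (P? : Decidable P) (xs ys : List A) →
                   length (filter P? (xs ++ ys)) ≡ length (filter P? xs) ℕ.+ length (filter P? ys)
length-filter-++ P? xs ys = ≡.trans (≡.cong length (ListP.filter-++ P? xs ys)) (ListP.length-++ (filter P? xs))

length-filter-map : ∀ {A B : Set} {P : B → Set} (P? : Decidable P) (h : A → B) (xs : List A) →
                    length (filter P? (map h xs)) ≡ length (filter (P? ∘ h) xs)
length-filter-map P? h []       = ≡.refl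
length-filter-map P? h (x ∷ xs) with does (P? (h x))
... | true  = ≡.cong suc (length-filter-map P? h xs)
... | false = length-filter-map P? h xs

length-filter-concatMap : ∀ {A B : Set} {P : B → Set} (P? : Decidable P) {n} (f : Fin n → A) (g : A → List B) →
                          length (filter P? (concatMap g (tabulate f))) ≡ sum (λ i → length (filter P? (g (f i))))
length-filter-concatMap P? {zero}  f g = ≡.refl
length-filter-concatMap P? {suc n} f g =
  ≡.trans (length-filter-++ P? (g (f Fin.zero)) _)
          (≡.cong (length (filter P? (g (f Fin.zero))) ℕ.+_) (length-filter-concatMap P? (f ∘ Fin.suc) g))

module TorusZeros {q : ℕ} (F : FiniteField q) where
  open FiniteField F hiding (zero)
  open UnitSums F
  open MultilinearPolynomials F
  import Relation.Binary.Reasoning.Setoid setoid as ≈-Reasoning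

  IsTorusZero : ∀ {n} → Multilinear n → (Fin n → Fin q) → Set
  IsTorusZero p s = (∀ i → ¬ enum (s i) ≈ 0#) × (⟦ p ⟧ (enum ∘ s) ≈ 0#)

  isTorusZero? : ∀ {n} (p : Multilinear n) → Decidable (IsTorusZero p)
  isTorusZero? p s = all? (λ i → ¬? (enum (s i) ≟ 0#)) ×-dec (⟦ p ⟧ (enum ∘ s) ≟ 0#)

  count-torus-zeros : ∀ {n} (p : Multilinear n) → length (filter (isTorusZero? p) (allFuns q n)) ≡ zeros p
  count-torus-zeros (leaf a) with a ≟ 0#
  ... | yes a≈0 = ≡.refl
  ... | no  a≉0 = ≡.refl
  count-torus-zeros {suc n} p@(node p₀ p₁) =
    ≡.trans (length-filter-concatMap (isTorusZero? p) {q} id _)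
            (sum-cong-≗ λ a → ≡.trans (length-filter-map (isTorusZero? p) _ (allFuns q n))
                                      (fibre a _ (λ _ → ≡.refl) (λ _ _ → ≡.refl)))
    where
    -- allFuns prepends the first coordinate by an anonymous function that is not definitionally
    -- Vector._∷_, so only its two defining equations are used.
    fibre : ∀ a (cons : (Fin n → Fin q) → Fin (suc n) → Fin q) →
            (∀ s → cons s Fin.zero ≡ a) → (∀ s i → cons s (Fin.suc i) ≡ s i) →
            length (filter (isTorusZero? p ∘ cons) (allFuns q n)) ≡ unitsOnly (enum a) (zeros (p [x₀≔ enum a ]))
    fibre a cons head tail with enum a ≟ 0#
    ... | yes a≈0 = ≡.cong length (ListP.filter-none (isTorusZero? p ∘ cons)
                      (All.universal (λ s z → proj₁ z Fin.zero (trans (reflexive (≡.cong enum (head s))) a≈0)) (allFuns q n)))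
    ... | no a≉0  = ≡.trans (≡.cong length (ListP.filter-≐ (isTorusZero? p ∘ cons) (isTorusZero? (p [x₀≔ enum a ]))
                                              (to , from) (allFuns q n)))
                            (count-torus-zeros (p [x₀≔ enum a ]))
      where
      enum-tail : ∀ s i → enum (cons s (Fin.suc i)) ≈ enum (s i)
      enum-tail s i = reflexive (≡.cong enum (tail s i))
      ⟦⟧-cons : ∀ s → ⟦ p ⟧ (enum ∘ cons s) ≈ ⟦ p [x₀≔ enum a ] ⟧ (enum ∘ s)
      ⟦⟧-cons s = begin
        ⟦ p₀ ⟧ (enum ∘ cons s ∘ Fin.suc) + enum (cons s Fin.zero) * ⟦ p₁ ⟧ (enum ∘ cons s ∘ Fin.suc)
          ≈⟨ +-cong (⟦⟧-cong (≈ᴹ-refl {p = p₀}) (enum-tail s))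
                    (*-cong (reflexive (≡.cong enum (head s))) (⟦⟧-cong (≈ᴹ-refl {p = p₁}) (enum-tail s))) ⟩
        ⟦ p₀ ⟧ (enum ∘ s) + enum a * ⟦ p₁ ⟧ (enum ∘ s)
          ≈⟨ +-cong refl (⟦·ᴹ⟧ (enum a) p₁ (enum ∘ s)) ⟨
        ⟦ p₀ ⟧ (enum ∘ s) + ⟦ enum a ·ᴹ p₁ ⟧ (enum ∘ s)
          ≈⟨ ⟦+ᴹ⟧ p₀ (enum a ·ᴹ p₁) (enum ∘ s) ⟨
        ⟦ p [x₀≔ enum a ] ⟧ (enum ∘ s) ∎
        where open ≈-Reasoning
      to : IsTorusZero p ∘ cons ⊆ IsTorusZero (p [x₀≔ enum a ])
      to {s} (units , root) = (λ i s≈0 → units (Fin.suc i) (trans (enum-tail s i) s≈0)) , trans (sym (⟦⟧-cons s)) root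
      from : IsTorusZero (p [x₀≔ enum a ]) ⊆ IsTorusZero p ∘ cons
      from {s} (units , root) = all-units , trans (⟦⟧-cons s) root
        where
        all-units : ∀ i → ¬ enum (cons s i) ≈ 0#
        all-units Fin.zero    c≈0 = a≉0 (trans (sym (reflexive (≡.cong enum (head s)))) c≈0)
        all-units (Fin.suc i) c≈0 = units i (trans (sym (enum-tail s i)) c≈0)

-- Lattice points of order polytopes

/1-cancel-≤ : ∀ z w → z ℚ./ 1 ℚ.≤ w ℚ./ 1 → z ℤ.≤ w
/1-cancel-≤ z w z≤w = ≡.subst₂ ℤ._≤_ (numerator z w) (numerator w z) (ℚP.drop-*≤* z≤w)
  where
  ↥/1 : ∀ z → ↥ (z ℚ./ 1) ≡ z
  ↥/1 z = ≡.trans (≡.sym (ℤP.*-identityʳ _))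
            (≡.trans (≡.cong (λ g → ↥ (z ℚ./ 1) ℤ.* + g) (≡.sym (GCD.gcd-zeroʳ ℤ.∣ z ∣))) (ℚP.↥-/ z 1))
  ↧/1 : ∀ z → ↧ (z ℚ./ 1) ≡ + 1
  ↧/1 z = ≡.trans (≡.sym (ℤP.*-identityʳ _))
            (≡.trans (≡.cong (λ g → ↧ (z ℚ./ 1) ℤ.* + g) (≡.sym (GCD.gcd-zeroʳ ℤ.∣ z ∣))) (ℚP.↧-/ z 1))
  numerator : ∀ z w → ↥ (z ℚ./ 1) ℤ.* ↧ (w ℚ./ 1) ≡ z
  numerator z w = ≡.trans (≡.cong₂ ℤ._*_ (↥/1 z) (↧/1 w)) (ℤP.*-identityʳ z)

Is01 : ℤ → Set
Is01 z = z ≡ + 0 ⊎ z ≡ + 1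

integer-in-[0,1] : ∀ z → 0ℚ ℚ.≤ z ℚ./ 1 → z ℚ./ 1 ℚ.≤ 1ℚ → Is01 z
integer-in-[0,1] (+ 0)           _   _   = inj₁ ≡.refl
integer-in-[0,1] (+ 1)           _   _   = inj₂ ≡.refl
integer-in-[0,1] (+ suc (suc k)) _   z≤1 with ℤ.+≤+ (ℕ.s≤s ()) ← /1-cancel-≤ (+ suc (suc k)) (+ 1) z≤1
integer-in-[0,1] -[1+ k ]        0≤z _   with () ← /1-cancel-≤ (+ 0) -[1+ k ] 0≤z

module OrderPolytope (P : FinPoset) where
  open FinPoset P

  private
    Combination : Set
    Combination = List (ℚ × (Fin size → Bool))

    Admissible : ℚ × (Fin size → Bool) → Set
    Admissible c = (0ℚ ℚ.≤ proj₁ c) × IsUpperIdeal P (proj₂ c)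

    weighted : (ℚ × (Fin size → Bool) → Bool) → Combination → ℚ
    weighted g cs = foldr ℚ._+_ 0ℚ (map (λ c → proj₁ c ℚ.* indicator P (g c)) cs)

    term-mono : ∀ w → 0ℚ ℚ.≤ w → ∀ b b′ → (b ≡ true → b′ ≡ true) → w ℚ.* indicator P b ℚ.≤ w ℚ.* indicator P b′
    term-mono w 0≤w false false _ = ℚP.≤-refl
    term-mono w 0≤w true  true  _ = ℚP.≤-refl
    term-mono w 0≤w false true  _ = ≡.subst₂ ℚ._≤_ (≡.sym (ℚP.*-zeroʳ w)) (≡.sym (ℚP.*-identityʳ w)) 0≤w
    term-mono w 0≤w true  false b⇒b′ with () ← b⇒b′ ≡.refl

    weighted-mono : ∀ g h cs → All Admissible cs → (∀ c → Admissible c → g c ≡ true → h c ≡ true) →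
                    weighted g cs ℚ.≤ weighted h cs
    weighted-mono g h []       []         g⇒h = ℚP.≤-refl
    weighted-mono g h (c ∷ cs) (ok ∷ oks) g⇒h =
      ℚP.+-mono-≤ (term-mono (proj₁ c) (proj₁ ok) (g c) (h c) (g⇒h c ok)) (weighted-mono g h cs oks g⇒h)

    weighted-false : ∀ cs → weighted (λ _ → false) cs ≡ 0ℚ
    weighted-false []       = ≡.refl
    weighted-false (c ∷ cs) = ≡.trans (≡.cong₂ ℚ._+_ (ℚP.*-zeroʳ (proj₁ c)) (weighted-false cs)) (ℚP.+-identityʳ 0ℚ)

    weighted-true : ∀ cs → weighted (λ _ → true) cs ≡ foldr ℚ._+_ 0ℚ (map proj₁ cs)
    weighted-true []       = ≡.refl
    weighted-true (c ∷ cs) = ≡.cong₂ ℚ._+_ (ℚP.*-identityʳ (proj₁ c)) (weighted-true cs)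

  module _ (u : LatticePoint P) where
    private
      cs      = proj₁ (proj₂ u)
      oks     = proj₁ (proj₂ (proj₂ u))
      total≡1 = proj₁ (proj₂ (proj₂ (proj₂ u)))
      value   = proj₂ (proj₂ (proj₂ (proj₂ u)))

    lattice-point-01 : ∀ i → Is01 (proj₁ u i)
    lattice-point-01 i = integer-in-[0,1] (proj₁ u i) 0≤ui ui≤1
      where
      0≤ui : 0ℚ ℚ.≤ proj₁ u i ℚ./ 1
      0≤ui = ≡.subst₂ ℚ._≤_ (weighted-false cs) (≡.sym (value i))
               (weighted-mono (λ _ → false) (λ c → proj₂ c i) cs oks (λ _ _ ()))
      ui≤1 : proj₁ u i ℚ./ 1 ℚ.≤ 1ℚ
      ui≤1 = ≡.subst₂ ℚ._≤_ (≡.sym (value i)) (≡.trans (weighted-true cs) total≡1)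
               (weighted-mono (λ c → proj₂ c i) (λ _ → true) cs oks (λ _ _ _ → ≡.refl))

    lattice-point-monotone : ∀ x y → y ≼ x → proj₁ u y ℤ.≤ proj₁ u x
    lattice-point-monotone x y y≼x = /1-cancel-≤ (proj₁ u y) (proj₁ u x)
      (≡.subst₂ ℚ._≤_ (≡.sym (value y)) (≡.sym (value x))
        (weighted-mono (λ c → proj₂ c y) (λ c → proj₂ c x) cs oks (λ c ok Iy → proj₂ ok x y Iy y≼x)))

    lattice-point-upward : ∀ x y → y ≼ x → proj₁ u y ≡ + 1 → proj₁ u x ≡ + 1
    lattice-point-upward x y y≼x uy≡1 with lattice-point-01 x
    ... | inj₂ ux≡1 = ux≡1
    ... | inj₁ ux≡0 with ℤ.+≤+ () ← ≡.subst₂ ℤ._≤_ uy≡1 ux≡0 (lattice-point-monotone x y y≼x)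

-- The toric code of Aₘ ⊕ Aₘ

bit : ℤ → Bool
bit z = does (z ℤ.≟ + 1)

ofBool : Bool → ℤ
ofBool true  = + 1
ofBool false = + 0

bit-ofBool : ∀ b → bit (ofBool b) ≡ b
bit-ofBool true  = ≡.refl
bit-ofBool false = ≡.refl

ofBool-bit : ∀ {z} → Is01 z → z ≡ ofBool (bit z)
ofBool-bit (inj₁ ≡.refl) = ≡.refl
ofBool-bit (inj₂ ≡.refl) = ≡.refl

bit-injective : ∀ {z w} → Is01 z → Is01 w → bit z ≡ bit w → z ≡ w
bit-injective z01 w01 bz≡bw = ≡.trans (ofBool-bit z01) (≡.trans (≡.cong ofBool bz≡bw) (≡.sym (ofBool-bit w01)))

ofBool-01 : ∀ b → Is01 (ofBool b)
ofBool-01 true  = inj₂ ≡.refl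
ofBool-01 false = inj₁ ≡.refl

is01? : ∀ z → Dec (Is01 z)
is01? z = (z ℤ.≟ + 0) ⊎-dec (z ℤ.≟ + 1)

bit-true : ∀ {z} → bit z ≡ true → z ≡ + 1
bit-true {z} bz≡true with z ℤ.≟ + 1
... | yes z≡1 = z≡1

module AntichainSum {q : ℕ} (F : FiniteField q) (m : ℕ) where
  open FiniteField F hiding (zero)
  open UnitSums F
  open MultilinearPolynomials F
  open Blocks m
  open TorusZeros F
  import Relation.Binary.Reasoning.Setoid setoid as ≈-Reasoning

  P : FinPoset
  P = Antichain m ⊕ Antichain m

  open OrderPolytope P
  module T = Toric F P

  bits : LatticePoint P → Fin (m ℕ.+ m) → Bool
  bits u = bit ∘ proj₁ u

  asTerm : Carrier × LatticePoint P → Term (m ℕ.+ m)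
  asTerm (c , u) = c , bits u

  toMultilinear : T.LP → Multilinear (m ℕ.+ m)
  toMultilinear f = sumTerms (map asTerm f)

  ^ℤ-bits : ∀ (u : LatticePoint P) i x → x T.^ℤ proj₁ u i ≈ (if bits u i then x else 1#)
  ^ℤ-bits u i x with proj₁ u i | lattice-point-01 u i
  ... | _ | inj₁ ≡.refl = refl
  ... | _ | inj₂ ≡.refl = *-identityʳ x

  monomial-bits : ∀ τ (u : LatticePoint P) → T.monomial τ (proj₁ u) ≈ ⟦ monomial (bits u) ⟧ τ
  monomial-bits τ u = begin
    foldr _*_ 1# (map (λ i → τ i T.^ℤ proj₁ u i) (allFin (m ℕ.+ m)))
      ≡⟨ ≡.cong (foldr _*_ 1#) (ListP.map-tabulate id (λ i → τ i T.^ℤ proj₁ u i)) ⟩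
    foldr _*_ 1# (tabulate (λ i → τ i T.^ℤ proj₁ u i))                ≈⟨ product-cong (λ i → ^ℤ-bits u i (τ i)) ⟩
    foldr _*_ 1# (tabulate (λ i → if bits u i then τ i else 1#))       ≈⟨ ⟦monomial⟧ (bits u) τ ⟨
    ⟦ monomial (bits u) ⟧ τ                                           ∎
    where
    open ≈-Reasoning
    product-cong : ∀ {n} {g h : Fin n → Carrier} → (∀ i → g i ≈ h i) → foldr _*_ 1# (tabulate g) ≈ foldr _*_ 1# (tabulate h)
    product-cong {zero}  g≈h = refl
    product-cong {suc n} g≈h = *-cong (g≈h Fin.zero) (product-cong (g≈h ∘ Fin.suc))

  eval-toMultilinear : ∀ (f : T.LP) τ → T.eval f τ ≈ ⟦ toMultilinear f ⟧ τ
  eval-toMultilinear []            τ = sym (⟦0ᴹ⟧ τ)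
  eval-toMultilinear ((c , u) ∷ f) τ = begin
    c * T.monomial τ (proj₁ u) + T.eval f τ                  ≈⟨ +-comm _ _ ⟩
    T.eval f τ + c * T.monomial τ (proj₁ u)                  ≈⟨ +-cong (eval-toMultilinear f τ) (*-cong refl (monomial-bits τ u)) ⟩
    ⟦ toMultilinear f ⟧ τ + c * ⟦ monomial (bits u) ⟧ τ      ≈⟨ +-cong refl (⟦·ᴹ⟧ c (monomial (bits u)) τ) ⟨
    ⟦ toMultilinear f ⟧ τ + ⟦ c ·ᴹ monomial (bits u) ⟧ τ     ≈⟨ ⟦+ᴹ⟧ (toMultilinear f) (c ·ᴹ monomial (bits u)) τ ⟨
    ⟦ toMultilinear ((c , u) ∷ f) ⟧ τ                        ∎
    where open ≈-Reasoning

  Z-toMultilinear : ∀ (f : T.LP) → T.Z f ≡ zeros (toMultilinear f)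
  Z-toMultilinear f = ≡.trans (≡.cong length (ListP.filter-≐ _ (isTorusZero? (toMultilinear f)) (to , from) (allFuns q (m ℕ.+ m))))
                  (count-torus-zeros (toMultilinear f))
    where
    to : ∀ {s} → (∀ i → ¬ enum (s i) ≈ 0#) × T.eval f (enum ∘ s) ≈ 0# → IsTorusZero (toMultilinear f) s
    to (units , root) = units , trans (sym (eval-toMultilinear f _)) root
    from : ∀ {s} → IsTorusZero (toMultilinear f) s → (∀ i → ¬ enum (s i) ≈ 0#) × T.eval f (enum ∘ s) ≈ 0#
    from (units , root) = units , trans (eval-toMultilinear f _) root

  bits-upward : ∀ (u : LatticePoint P) i → bits u (i Fin.↑ˡ m) ≡ true → ∀ j → bits u (m Fin.↑ʳ j) ≡ true
  bits-upward u i bits-i j = ≡.cong bit (lattice-point-upward u (m Fin.↑ʳ j) (i Fin.↑ˡ m) below (bit-true bits-i))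
    where
    below : FinPoset._≼_ P (i Fin.↑ˡ m) (m Fin.↑ʳ j)
    below = ≡.subst₂ (_≼⊎_ (Antichain m) (Antichain m)) (≡.sym (FinP.splitAt-↑ˡ m i m)) (≡.sym (FinP.splitAt-↑ʳ m m j)) tt

  OrdinalShape-toMultilinear : ∀ (f : T.LP) → OrdinalShape m (toMultilinear f)
  OrdinalShape-toMultilinear []            = OrdinalShape-0ᴹ m
  OrdinalShape-toMultilinear ((c , u) ∷ f) =
    OrdinalShape-+ᴹ·ᴹ m c (OrdinalShape-toMultilinear f) (OrdinalShape-monomial m (bits u) (bits-upward u))

  private
    matches : ∀ (v : Fin (m ℕ.+ m) → ℤ) (t : Carrier × LatticePoint P) → Dec (∀ i → proj₁ (proj₂ t) i ≡ v i)
    matches v t = all? (λ i → proj₁ (proj₂ t) i ℤ.≟ v i)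

    sum-coefficients : T.LP → Carrier
    sum-coefficients = foldr _+_ 0# ∘ map proj₁

  coeff-toMultilinear : ∀ (f : T.LP) v S → (∀ i → v i ≡ ofBool (S i)) → T.coeff f v ≈ coefficient (toMultilinear f) S
  coeff-toMultilinear []            v S v≡S = sym (coefficient-0ᴹ S)
  coeff-toMultilinear ((c , u) ∷ f) v S v≡S with matches v (c , u)
  ... | yes u≡v = begin
    T.coeff ((c , u) ∷ f) v                                                ≡⟨ ≡.cong sum-coefficients (ListP.filter-accept (matches v) {xs = f} u≡v) ⟩
    c + T.coeff f v                                                        ≈⟨ +-comm c _ ⟩
    T.coeff f v + c                                                        ≈⟨ +-cong (coeff-toMultilinear f v S v≡S) (sym (*-identityʳ c)) ⟩
    coefficient (toMultilinear f) S + c * 1#                               ≈⟨ +-cong refl (*-cong refl (coefficient-monomial-≗ bits≗S)) ⟨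
    coefficient (toMultilinear f) S + c * coefficient (monomial (bits u)) S ≈⟨ coefficient-+ᴹ·ᴹ c (toMultilinear f) (monomial (bits u)) S ⟨
    coefficient (toMultilinear ((c , u) ∷ f)) S                            ∎
    where
    open ≈-Reasoning
    bits≗S : bits u ≗ S
    bits≗S i = ≡.trans (≡.cong bit (≡.trans (u≡v i) (v≡S i))) (bit-ofBool (S i))
  ... | no u≢v = begin
    T.coeff ((c , u) ∷ f) v                                                ≡⟨ ≡.cong sum-coefficients (ListP.filter-reject (matches v) {xs = f} u≢v) ⟩
    T.coeff f v                                                            ≈⟨ coeff-toMultilinear f v S v≡S ⟩
    coefficient (toMultilinear f) S                                        ≈⟨ +-identityʳ _ ⟨
    coefficient (toMultilinear f) S + 0#                                   ≈⟨ +-cong refl (zeroʳ c) ⟨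
    coefficient (toMultilinear f) S + c * 0#                               ≈⟨ +-cong refl (*-cong refl (coefficient-monomial-≭ bits≭S)) ⟨
    coefficient (toMultilinear f) S + c * coefficient (monomial (bits u)) S ≈⟨ coefficient-+ᴹ·ᴹ c (toMultilinear f) (monomial (bits u)) S ⟨
    coefficient (toMultilinear ((c , u) ∷ f)) S                            ∎
    where
    open ≈-Reasoning
    bits≭S : ¬ bits u ≗ S
    bits≭S bits≗S = u≢v (λ i → bit-injective (lattice-point-01 u i) (≡.subst Is01 (≡.sym (v≡S i)) (ofBool-01 (S i)))
                                  (≡.trans (bits≗S i) (≡.trans (≡.sym (bit-ofBool (S i))) (≡.cong bit (≡.sym (v≡S i))))))

  coeff-non-01 : ∀ (f : T.LP) v → ¬ (∀ i → Is01 (v i)) → T.coeff f v ≈ 0#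
  coeff-non-01 f v v-not-01 = reflexive (≡.cong sum-coefficients (ListP.filter-none (matches v) (All.universal no-match f)))
    where
    no-match : ∀ (t : Carrier × LatticePoint P) → ¬ (∀ i → proj₁ (proj₂ t) i ≡ v i)
    no-match (c , u) u≡v = v-not-01 (λ i → ≡.subst Is01 (u≡v i) (lattice-point-01 u i))

  NonZero-toMultilinear : ∀ (f : T.LP) → T.NonZeroPoly f → NonZeroᴹ (toMultilinear f)
  NonZero-toMultilinear f (v , coeff≉0) with all? (λ i → is01? (v i))
  ... | yes v01   = coefficient-NonZero (toMultilinear f) (bit ∘ v)
                      (λ c≈0 → coeff≉0 (trans (coeff-toMultilinear f v (bit ∘ v) (λ i → ofBool-bit (v01 i))) c≈0))
  ... | no  ¬v01 = ⊥-elim (coeff≉0 (coeff-non-01 f v ¬v01))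

  point : (Fin m → Bool) → LatticePoint P
  point S = ofBool ∘ I , (1ℚ , I) ∷ [] , (0≤1 , upper) ∷ [] , ≡.refl , λ i → value (I i)
    where
    I = padFalse m S
    0≤1 : 0ℚ ℚ.≤ 1ℚ
    0≤1 = ℚ.*≤* (ℤ.+≤+ ℕ.z≤n)
    value : ∀ b → ofBool b ℚ./ 1 ≡ 1ℚ ℚ.* indicator P b ℚ.+ 0ℚ
    value true  = ≡.refl
    value false = ≡.refl
    upper-on-blocks : ∀ sx sy → [ (λ _ → false) , S ] sy ≡ true → _≼⊎_ (Antichain m) (Antichain m) sy sx →
                      [ (λ _ → false) , S ] sx ≡ true
    upper-on-blocks (inj₂ j) (inj₂ .j) Sj ≡.refl = Sj
    upper-on-blocks sx       (inj₁ _)  ()  _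
    upper : IsUpperIdeal P I
    upper x y Iy y≼x = ≡.trans (padFalse-splitAt m S x)
      (upper-on-blocks (splitAt m x) (splitAt m y) (≡.trans (≡.sym (padFalse-splitAt m S y)) Iy) y≼x)

  liftTerm : Term m → Carrier × LatticePoint P
  liftTerm (c , S) = c , point S

  toMultilinear-liftTerm : ∀ (ts : List (Term m)) → toMultilinear (map liftTerm ts) ≈ᴹ inner m (sumTerms ts)
  toMultilinear-liftTerm []             = ≈ᴹ-sym (inner-0ᴹ m)
  toMultilinear-liftTerm ((c , S) ∷ ts) =
    ≈ᴹ-trans (+ᴹ-cong (toMultilinear-liftTerm ts) (·ᴹ-cong refl (≈ᴹ-reflexive monomial-point)))
             (≈ᴹ-sym (inner-+ᴹ·ᴹ m c (sumTerms ts) (monomial S)))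
    where
    monomial-point : monomial (bits (point S)) ≡ inner m (monomial S)
    monomial-point = ≡.trans (monomial-≗ (λ i → bit-ofBool (padFalse m S i))) (monomial-padFalse m S)

  extremal : T.LP
  extremal = map liftTerm (terms (∏[x-1] m))

  toMultilinear-extremal : toMultilinear extremal ≈ᴹ inner m (∏[x-1] m)
  toMultilinear-extremal = ≈ᴹ-trans (toMultilinear-liftTerm (terms (∏[x-1] m))) (inner-cong m (sumTerms-terms (∏[x-1] m)))

  Z-extremal : T.Z extremal ℕ.+ q₋₁ ^ m ℕ.* q₋₂ ^ m ≡ q₋₁ ^ m ℕ.* q₋₁ ^ m
  Z-extremal = begin
    T.Z extremal ℕ.+ q₋₁ ^ m ℕ.* q₋₂ ^ m                   ≡⟨ ≡.cong (ℕ._+ q₋₁ ^ m ℕ.* q₋₂ ^ m) Z≡ ⟩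
    q₋₁ ^ m ℕ.* zeros (∏[x-1] m) ℕ.+ q₋₁ ^ m ℕ.* q₋₂ ^ m   ≡⟨ ℕP.*-distribˡ-+ (q₋₁ ^ m) (zeros (∏[x-1] m)) (q₋₂ ^ m) ⟨
    q₋₁ ^ m ℕ.* (zeros (∏[x-1] m) ℕ.+ q₋₂ ^ m)             ≡⟨ ≡.cong (q₋₁ ^ m ℕ.*_) (zeros-∏[x-1] m) ⟩
    q₋₁ ^ m ℕ.* q₋₁ ^ m                                    ∎
    where
    open ≡.≡-Reasoning
    Z≡ : T.Z extremal ≡ q₋₁ ^ m ℕ.* zeros (∏[x-1] m)
    Z≡ = ≡.trans (Z-toMultilinear extremal) (≡.trans (zeros-cong toMultilinear-extremal) (zeros-inner m (∏[x-1] m)))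

  NonZero-extremal : T.NonZeroPoly extremal
  NonZero-extremal = ofBool ∘ padFalse m (λ _ → true) , λ coeff≈0 → 1≉0 (trans (sym coeff≈1) coeff≈0)
    where
    open ≈-Reasoning
    coeff≈1 : T.coeff extremal (ofBool ∘ padFalse m (λ _ → true)) ≈ 1#
    coeff≈1 = begin
      T.coeff extremal (ofBool ∘ padFalse m (λ _ → true))              ≈⟨ coeff-toMultilinear extremal _ (padFalse m (λ _ → true)) (λ _ → ≡.refl) ⟩
      coefficient (toMultilinear extremal) (padFalse m (λ _ → true))   ≈⟨ coefficient-cong (padFalse m (λ _ → true)) toMultilinear-extremal ⟩
      coefficient (inner m (∏[x-1] m)) (padFalse m (λ _ → true))       ≡⟨ coefficient-inner m (∏[x-1] m) (λ _ → true) ⟩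
      coefficient (∏[x-1] m) (λ _ → true)                              ≡⟨ ≡.trans (coefficient-top (∏[x-1] m)) (top-∏[x-1] m) ⟩
      1#                                                               ∎

  Z-NonZero : ∀ (f : T.LP) → T.NonZeroPoly f → T.Z f ℕ.+ q₋₁ ^ m ℕ.* q₋₂ ^ m ≤ q₋₁ ^ m ℕ.* q₋₁ ^ m
  Z-NonZero f f≠0 rewrite Z-toMultilinear f
    with zeros-OrdinalShape m (toMultilinear f) (OrdinalShape-toMultilinear f) (NonZero-toMultilinear f f≠0)
  ... | inj₁ bound = ≡.subst (λ k → zeros (toMultilinear f) ℕ.+ k ≤ q₋₁ ^ m ℕ.* q₋₁ ^ m)
                             (ℕP.*-comm (q₋₂ ^ m) (q₋₁ ^ m)) bound
  ... | inj₂ bound = bound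

open import Data.Nat using (_<_; _*_)

lemma5p2 : (q : ℕ) → 3 < q → (F : FiniteField q) → (m : ℕ) → 1 ≤ m →
    Toric.IsMinimumDistance F (Antichain m ⊕ Antichain m) ((q ∸ 1) ^ m * (q ∸ 2) ^ m)
lemma5p2 q _ F m _ = T.Z extremal , (extremal , NonZero-extremal , ≡.refl) , maximal , distance
  where
  open UnitSums F
  open AntichainSum F m
  maximal : ∀ f → T.NonZeroPoly f → T.Z f ≤ T.Z extremal
  maximal f f≠0 = ℕP.+-cancelʳ-≤ _ _ _ (ℕP.≤-trans (Z-NonZero f f≠0) (ℕP.≤-reflexive (≡.sym Z-extremal)))
  q-1≡q₋₁ : q ∸ 1 ≡ q₋₁
  q-1≡q₋₁ = ≡.cong (_∸ 1) q≡1+q₋₁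
  q-2≡q₋₂ : q ∸ 2 ≡ q₋₂
  q-2≡q₋₂ = ≡.trans (≡.cong (_∸ 2) q≡1+q₋₁) (≡.cong (_∸ 1) q₋₁≡1+q₋₂)
  distance : (q ∸ 1) ^ m * (q ∸ 2) ^ m ≡ (q ∸ 1) ^ (m ℕ.+ m) ∸ T.Z extremal
  distance rewrite q-1≡q₋₁ | q-2≡q₋₂ | ℕP.^-distribˡ-+-* q₋₁ m m | ≡.sym Z-extremal =
    ≡.sym (ℕP.m+n∸m≡n (T.Z extremal) _)
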